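{- Let $k$ be a positive integer, $n_0,m_0$ nonnegative integers and $a\in\{ -1,1\}$, and set $(\sigma_1,\dots,\sigma_{k-1},\sigma_k):=(1,\dots,1,a)$. Define \[ F^{(a)}_{n_0,m_0;k}(z,q):= \sum_{\substack{n_1,\dots,n_k\geq 0 \\ m_1,\dots, m_k\geq 0}} \frac{z^{n_1}}{(q)_{n_k+m_k}} \prod_{i=1}^k q^{n_i^2-\sigma_i n_im_i+m_i^2} {n_{i-1} \brack n_i}{m_{i-1} \brack m_i}. \] Then \[ F_{n_0,m_0;k}^{(-1)}(z,q)=\sum_{\substack{n_1,\dots,n_k\geq 0 \\ m_1,\dots,m_{k-1}\geq 0}} \frac{z^{n_1} q^{n_k^2}}{(q)_{m_0-n_1+m_1}}\, {n_0 \brack n_1} \prod_{i=1}^{k-1} q^{n_i^2-n_im_i+m_i^2} {n_i \brack n_{i+1}}{n_i-n_{i+1}+m_{i+1} \brack m_i}, \] where $m_k:=2n_k$, and \[ F_{n_0,m_0;k}^{(1)}(z,q)=\sum_{\substack{n_1,\dots,n_k\geq 0 \\ m_1,\dots,m_k\geq 0}} \frac{z^{n_1}q^{\sum_{i=1}^k(n_i^2-n_im_i+m_i^2)}} {(q)_{m_0-n_1+m_1}}\,{n_0 \brack n_1}{2n_k \brack m_k} \prod_{i=1}^{k-1} {n_i \brack n_{i+1}}{n_i-n_{i+1}+m_{i+1} \brack m_i}. \]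
   Context: $(q)_n=(q;q)_n=(q;q)_\infty/(q^{n+1};q)_\infty$ for $n\in\mathbb{Z}$, where $(a;q)_\infty=\prod_{i\ge0}(1-aq^i)$; in particular $1/(q)_n=0$ for $n<0$. For $n,m\in\mathbb{Z}$, ${n\brack m}=\frac{(q)_n}{(q)_m(q)_{n-m}}$ if $0\leq m\leq n$ and $0$ otherwise. These are polynomials in $z$ with coefficients rational in $q$; empty products are $1$. -}

module Defs where

open import Data.Nat as ℕ using (ℕ; zero; suc)
open import Data.Integer as ℤ using (ℤ; +_; -[1+_])
open import Data.Rational as ℚ using (ℚ; 0ℚ; 1ℚ; _+_; _*_; _-_; 1/_)
open import Data.Rational.Properties using (_≟_)
open import Data.List using (List; []; _∷_)
open import Data.Vec using (Vec; []; _∷_; toList)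
open import Relation.Nullary using (yes; no)
open import Data.Bool using (if_then_else_)

-- total inverse (0 at 0); only ever applied to nonzero values in the
-- statement, where it is the genuine inverse
inv : ℚ → ℚ
inv p with p ≟ 0ℚ
... | yes _  = 0ℚ
... | no p≢0 = 1/_ p {{ℚ.≢-nonZero p≢0}}

_^ℕ_ : ℚ → ℕ → ℚ
x ^ℕ zero  = 1ℚ
x ^ℕ suc n = x * (x ^ℕ n)

_^ℤ_ : ℚ → ℤ → ℚ
x ^ℤ (+ n)     = x ^ℕ n
x ^ℤ -[1+ n ]  = inv (x ^ℕ suc n)

poch : ℚ → ℕ → ℚ
poch q zero    = 1ℚ
poch q (suc n) = poch q n * (1ℚ - q ^ℕ suc n)

invPoch : ℚ → ℤ → ℚ
invPoch q (+ n)    = inv (poch q n)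
invPoch q -[1+ _ ] = 0ℚ

qbinom : ℚ → ℤ → ℤ → ℚ
qbinom q (+ n) (+ m) with m ℕ.≤? n
... | yes _ = poch q n * inv (poch q m * poch q (n ℕ.∸ m))
... | no _  = 0ℚ
qbinom q _ _ = 0ℚ

sumTo : ℕ → (ℕ → ℚ) → ℚ
sumTo zero    f = f 0
sumTo (suc B) f = sumTo B f + f (suc B)

sumBox : (k B : ℕ) → (Vec ℕ k → ℚ) → ℚ
sumBox zero    B f = f []
sumBox (suc k) B f = sumTo B (λ j → sumBox k B (λ v → f (j ∷ v)))

prodFrom : ℕ → ℕ → (ℕ → ℚ) → ℚ
prodFrom a zero      f = 1ℚ
prodFrom a (suc len) f = f a * prodFrom (suc a) len f

prod1 : ℕ → (ℕ → ℚ) → ℚ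
prod1 K f = prodFrom 1 K f

sumℤ1 : ℕ → (ℕ → ℤ) → ℤ
sumℤ1 zero    f = + 0
sumℤ1 (suc K) f = sumℤ1 K f ℤ.+ f (suc K)

nth : List ℕ → ℕ → ℕ
nth []       _       = 0
nth (x ∷ xs) zero    = x
nth (x ∷ xs) (suc i) = nth xs i

seq : ℕ → List ℕ → ℕ → ℕ
seq d xs zero    = d
seq d xs (suc i) = nth xs i

ι : ℕ → ℤ
ι n = + n

ex : ℤ → ℕ → ℕ → ℤ
ex σ n m = ι n ℤ.* ι n ℤ.- σ ℤ.* (ι n ℤ.* ι m) ℤ.+ ι m ℤ.* ι m

sig : ℤ → ℕ → ℕ → ℤ
sig a k i = if i ℕ.≡ᵇ k then a else + 1

-- Truncation of F^{(a)}_{n0,m0;k}(z,q): n_1..n_k, m_1..m_k ranging over [0,B]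
Ftr : (a : ℤ) (n0 m0 k : ℕ) (z q : ℚ) (B : ℕ) → ℚ
Ftr a n0 m0 k z q B =
  sumBox k B λ nv → sumBox k B λ mv →
    let n = seq n0 (toList nv)
        m = seq m0 (toList mv)
    in (z ^ℕ n 1) * invPoch q (ι (n k) ℤ.+ ι (m k))
       * prod1 k (λ i → (q ^ℤ ex (sig a k i) (n i) (m i))
                        * qbinom q (ι (n (ℕ.pred i))) (ι (n i))
                        * qbinom q (ι (m (ℕ.pred i))) (ι (m i)))

-- Truncation of the right-hand side for a = -1: n_1..n_k, m_1..m_{k-1} in [0,B],
-- with m_k := 2 n_k
Rminus : (n0 m0 k : ℕ) (z q : ℚ) (B : ℕ) → ℚ
Rminus n0 m0 k z q B =
  sumBox k B λ nv → sumBox (k ℕ.∸ 1) B λ mv →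
    let n = seq n0 (toList nv)
        m = seq m0 (toList mv Data.List.++ (2 ℕ.* n k ∷ []))
    in (z ^ℕ n 1) * (q ^ℤ (ι (n k) ℤ.* ι (n k)))
       * invPoch q (ι m0 ℤ.- ι (n 1) ℤ.+ ι (m 1))
       * qbinom q (ι n0) (ι (n 1))
       * prod1 (k ℕ.∸ 1) (λ i → (q ^ℤ ex (+ 1) (n i) (m i))
                        * qbinom q (ι (n i)) (ι (n (suc i)))
                        * qbinom q (ι (n i) ℤ.- ι (n (suc i)) ℤ.+ ι (m (suc i))) (ι (m i)))
  where import Data.List

Rplus : (n0 m0 k : ℕ) (z q : ℚ) (B : ℕ) → ℚ
Rplus n0 m0 k z q B =
  sumBox k B λ nv → sumBox k B λ mv →
    let n = seq n0 (toList nv)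
        m = seq m0 (toList mv)
    in (z ^ℕ n 1) * (q ^ℤ sumℤ1 k (λ i → ex (+ 1) (n i) (m i)))
       * invPoch q (ι m0 ℤ.- ι (n 1) ℤ.+ ι (m 1))
       * qbinom q (ι n0) (ι (n 1))
       * qbinom q (ι (2 ℕ.* n k)) (ι (m k))
       * prod1 (k ℕ.∸ 1) (λ i → qbinom q (ι (n i)) (ι (n (suc i)))
                        * qbinom q (ι (n i) ℤ.- ι (n (suc i)) ℤ.+ ι (m (suc i))) (ι (m i)))

-- For fixed n₁,…,n_k both sides are iterated sums over the m_i, and they are matched layer by
-- layer from the outside in.  The engine is the symmetry in M and c of the kernel
--   K_n(M, c) = Σ_m q^(T(m−n) + T(m−1)) [M, m] / (q)_(c−n+m),   T(y) = y(y+1)/2 :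
-- by q-Pascal in M, and by 1/(q)_x = 1/(q)_(x−1) + q^x/(q)_x in c, both K_n(M+1, c) and
-- K_n(M, c+1) equal K_n(M, c) + q^(M resp. c) K_(n−1)(M, c), with the same initial value.
-- As n² − nm + m² = T(m−n) + T(m−1) + T(n), the symmetry turns
--   Σ_(m₁) q^(n₁² − n₁m₁ + m₁²) [m₀, m₁] / (q)_(m₁−n₂+m₂)  into
--   Σ_(m₁) q^(n₁² − n₁m₁ + m₁²) [n₁−n₂+m₂, m₁] / (q)_(m₀−n₁+m₁),
-- moving the reciprocal Pochhammer symbol one layer outwards.  At the innermost layer the same
-- step yields [2n_k, m_k] for a = 1; for a = −1 the exponent is n² + nm + m² and the kernel
-- collapses to the single term m_k = 2n_k.  Truncating the sums at B ≥ 2(n₀ + m₀) loses nothing,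
-- as the q-binomials vanish unless m_i ≤ m₀ (left-hand side) and m_i ≤ 2n_i ≤ 2n₀ (right-hand sides).

module Submission where

open import Defs
open import Data.Nat as ℕ using (ℕ; zero; suc; _∸_; z≤n; s≤s)
import Data.Nat.Properties as ℕP
import Data.Nat.Tactic.RingSolver as ℕ-Ring
open import Data.Integer as ℤ using (ℤ; +_; -[1+_])
import Data.Integer.Properties as ℤP
open import Data.Integer.Tactic.RingSolver using (solve-∀)
open import Data.Rational as ℚ using (ℚ; 0ℚ; 1ℚ; _+_; _*_; _-_; -_; ∣_∣)
import Data.Rational.Properties as ℚP
open import Data.Rational.Solver using (module +-*-Solver)
open import Data.Vec using (Vec; []; _∷_; toList)
open import Data.List using (List; _++_) renaming ([] to []ₗ; _∷_ to _∷ₗ_)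
open import Data.Product using (_×_; _,_)
open import Data.Sum using (inj₁; inj₂; [_,_]′)
open import Data.Empty using (⊥-elim)
open import Relation.Nullary using (Dec; yes; no)
open import Relation.Binary.PropositionalEquality
open import Relation.Binary.Definitions using (tri<; tri≈; tri>)
open import Algebra.Apartness.Properties.HeytingCommutativeRing ℚP.heytingCommutativeRing
  using (x#0y#0→xy#0)
open import Algebra.Properties.Group ℚP.+-0-group using (x∙y⁻¹≈ε⇒x≈y)

inv-inverseʳ : ∀ p → p ≢ 0ℚ → p * inv p ≡ 1ℚ
inv-inverseʳ p p≢0 with p ℚP.≟ 0ℚ
... | yes p≡0 = ⊥-elim (p≢0 p≡0)
... | no  p≢0 = ℚP.*-inverseʳ p {{ℚ.≢-nonZero p≢0}}

inv-inverseˡ : ∀ p → p ≢ 0ℚ → inv p * p ≡ 1ℚ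
inv-inverseˡ p p≢0 = trans (ℚP.*-comm (inv p) p) (inv-inverseʳ p p≢0)

x*d/d≡x : ∀ x {d} → d ≢ 0ℚ → x * d * inv d ≡ x
x*d/d≡x x {d} d≢0 =
  trans (ℚP.*-assoc x d (inv d)) (trans (cong (x *_) (inv-inverseʳ d d≢0)) (ℚP.*-identityʳ x))

x/d*d≡x : ∀ x {d} → d ≢ 0ℚ → x * inv d * d ≡ x
x/d*d≡x x {d} d≢0 =
  trans (ℚP.*-assoc x (inv d) d) (trans (cong (x *_) (inv-inverseˡ d d≢0)) (ℚP.*-identityʳ x))

*-cancelʳ-≢0 : ∀ x y {d} → d ≢ 0ℚ → x * d ≡ y * d → x ≡ y
*-cancelʳ-≢0 x y {d} d≢0 eq =
  trans (sym (x*d/d≡x x d≢0)) (trans (cong (_* inv d) eq) (x*d/d≡x y d≢0))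

zeroʳ-cong : ∀ x y {r} → r ≡ 0ℚ → x * r ≡ y * r
zeroʳ-cong x y r≡0 = trans (cong (x *_) r≡0) (trans (ℚP.*-zeroʳ x) (sym (trans (cong (y *_) r≡0) (ℚP.*-zeroʳ y))))

zeroˡ-cong : ∀ x y {r} → r ≡ 0ℚ → r * x ≡ r * y
zeroˡ-cong x y r≡0 = trans (cong (_* x) r≡0) (trans (ℚP.*-zeroˡ x) (sym (trans (cong (_* y) r≡0) (ℚP.*-zeroˡ y))))

*-≢0 : ∀ {a b} → a ≢ 0ℚ → b ≢ 0ℚ → a * b ≢ 0ℚ
*-≢0 = x#0y#0→xy#0

^ℕ-distribˡ-+-* : ∀ x a b → x ^ℕ (a ℕ.+ b) ≡ x ^ℕ a * x ^ℕ b
^ℕ-distribˡ-+-* x zero    b = sym (ℚP.*-identityˡ _)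
^ℕ-distribˡ-+-* x (suc a) b = trans (cong (x *_) (^ℕ-distribˡ-+-* x a b)) (sym (ℚP.*-assoc x _ _))

∣^ℕ∣ : ∀ x i → ∣ x ^ℕ i ∣ ≡ ∣ x ∣ ^ℕ i
∣^ℕ∣ x zero    = refl
∣^ℕ∣ x (suc i) = trans (ℚP.∣p*q∣≡∣p∣*∣q∣ x (x ^ℕ i)) (cong (∣ x ∣ *_) (∣^ℕ∣ x i))

module _ (r : ℚ) .{{_ : ℚ.NonNegative r}} where
  open ℚP.≤-Reasoning

  ^ℕ-≤1 : r ℚ.≤ 1ℚ → ∀ j → r ^ℕ j ℚ.≤ 1ℚ
  ^ℕ-≤1 r≤1 zero    = ℚP.≤-refl
  ^ℕ-≤1 r≤1 (suc j) = begin
    r * r ^ℕ j  ≤⟨ ℚP.*-monoˡ-≤-nonNeg r (^ℕ-≤1 r≤1 j) ⟩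
    r * 1ℚ      ≡⟨ ℚP.*-identityʳ r ⟩
    r           ≤⟨ r≤1 ⟩
    1ℚ          ∎

  1≤^ℕ : 1ℚ ℚ.≤ r → ∀ j → 1ℚ ℚ.≤ r ^ℕ j
  1≤^ℕ 1≤r zero    = ℚP.≤-refl
  1≤^ℕ 1≤r (suc j) = begin
    1ℚ          ≤⟨ 1≤r ⟩
    r           ≡⟨ ℚP.*-identityʳ r ⟨
    r * 1ℚ      ≤⟨ ℚP.*-monoˡ-≤-nonNeg r (1≤^ℕ 1≤r j) ⟩
    r * r ^ℕ j  ∎

  ^ℕ-suc-<1 : r ℚ.< 1ℚ → ∀ i → r ^ℕ suc i ℚ.< 1ℚ
  ^ℕ-suc-<1 r<1 i = begin-strict
    r * r ^ℕ i  ≤⟨ ℚP.*-monoˡ-≤-nonNeg r (^ℕ-≤1 (ℚP.<⇒≤ r<1) i) ⟩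
    r * 1ℚ      ≡⟨ ℚP.*-identityʳ r ⟩
    r           <⟨ r<1 ⟩
    1ℚ          ∎

  1<^ℕ-suc : 1ℚ ℚ.< r → ∀ i → 1ℚ ℚ.< r ^ℕ suc i
  1<^ℕ-suc 1<r i = begin-strict
    1ℚ          <⟨ 1<r ⟩
    r           ≡⟨ ℚP.*-identityʳ r ⟨
    r * 1ℚ      ≤⟨ ℚP.*-monoˡ-≤-nonNeg r (1≤^ℕ (ℚP.<⇒≤ 1<r) i) ⟩
    r * r ^ℕ i  ∎

  ^ℕ-suc≡1⇒≡1 : ∀ i → r ^ℕ suc i ≡ 1ℚ → r ≡ 1ℚ
  ^ℕ-suc≡1⇒≡1 i rⁱ⁺¹≡1 with ℚP.<-cmp r 1ℚ
  ... | tri< r<1 _ _ = ⊥-elim (ℚP.<-irrefl rⁱ⁺¹≡1 (^ℕ-suc-<1 r<1 i))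
  ... | tri≈ _ r≡1 _ = r≡1
  ... | tri> _ _ 1<r = ⊥-elim (ℚP.<-irrefl (sym rⁱ⁺¹≡1) (1<^ℕ-suc 1<r i))

^ℕ-suc≢1 : ∀ q → q ≢ 1ℚ → q ≢ - 1ℚ → ∀ i → q ^ℕ suc i ≢ 1ℚ
^ℕ-suc≢1 q q≢1 q≢-1 i qⁱ⁺¹≡1 =
  [ (λ ∣q∣≡q  → q≢1 (trans (sym ∣q∣≡q) ∣q∣≡1))
  , (λ ∣q∣≡-q → q≢-1 (ℚP.neg-injective (trans (sym ∣q∣≡-q) ∣q∣≡1)))
  ]′
  (ℚP.∣p∣≡p∨∣p∣≡-p q)
  where
    ∣q∣≡1 : ∣ q ∣ ≡ 1ℚ
    ∣q∣≡1 = ^ℕ-suc≡1⇒≡1 ∣ q ∣ {{ℚP.∣-∣-nonNeg q}} i (trans (sym (∣^ℕ∣ q (suc i))) (cong ∣_∣ qⁱ⁺¹≡1))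

1-^ℕ-suc≢0 : ∀ q → q ≢ 1ℚ → q ≢ - 1ℚ → ∀ i → 1ℚ - q ^ℕ suc i ≢ 0ℚ
1-^ℕ-suc≢0 q q≢1 q≢-1 i 1-qⁱ⁺¹≡0 = ^ℕ-suc≢1 q q≢1 q≢-1 i (sym (x∙y⁻¹≈ε⇒x≈y 1ℚ (q ^ℕ suc i) 1-qⁱ⁺¹≡0))

poch≢0 : ∀ q → q ≢ 1ℚ → q ≢ - 1ℚ → ∀ n → poch q n ≢ 0ℚ
poch≢0 q q≢1 q≢-1 zero    ()
poch≢0 q q≢1 q≢-1 (suc n) = *-≢0 (poch≢0 q q≢1 q≢-1 n) (1-^ℕ-suc≢0 q q≢1 q≢-1 n)


sumTo-cong : ∀ B {f g : ℕ → ℚ} → (∀ j → j ℕ.≤ B → f j ≡ g j) → sumTo B f ≡ sumTo B g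
sumTo-cong zero    f≗g = f≗g 0 z≤n
sumTo-cong (suc B) f≗g =
  cong₂ _+_ (sumTo-cong B (λ j j≤B → f≗g j (ℕP.m≤n⇒m≤1+n j≤B))) (f≗g (suc B) ℕP.≤-refl)

sumTo-zero : ∀ B → sumTo B (λ _ → 0ℚ) ≡ 0ℚ
sumTo-zero zero    = refl
sumTo-zero (suc B) = cong (_+ 0ℚ) (sumTo-zero B)

sumTo-distrib-+ : ∀ B (f g : ℕ → ℚ) → sumTo B (λ j → f j + g j) ≡ sumTo B f + sumTo B g
sumTo-distrib-+ zero    f g = refl
sumTo-distrib-+ (suc B) f g = trans (cong (_+ (f (suc B) + g (suc B))) (sumTo-distrib-+ B f g))
  (solve 4 (λ a b c d → (a :+ b) :+ (c :+ d) := (a :+ c) :+ (b :+ d)) refl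
     (sumTo B f) (sumTo B g) (f (suc B)) (g (suc B)))
  where open +-*-Solver

sumTo-*ˡ : ∀ B c (f : ℕ → ℚ) → sumTo B (λ j → c * f j) ≡ c * sumTo B f
sumTo-*ˡ zero    c f = refl
sumTo-*ˡ (suc B) c f = trans (cong (_+ c * f (suc B)) (sumTo-*ˡ B c f)) (sym (ℚP.*-distribˡ-+ c _ _))

sumTo-*ʳ : ∀ B c (f : ℕ → ℚ) → sumTo B (λ j → f j * c) ≡ sumTo B f * c
sumTo-*ʳ B c f = trans (sumTo-cong B (λ j _ → ℚP.*-comm (f j) c))
  (trans (sumTo-*ˡ B c f) (ℚP.*-comm c _))

sumTo-suc : ∀ B (f : ℕ → ℚ) → sumTo (suc B) f ≡ f 0 + sumTo B (λ j → f (suc j))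
sumTo-suc zero    f = refl
sumTo-suc (suc B) f =
  trans (cong (_+ f (suc (suc B))) (sumTo-suc B f)) (ℚP.+-assoc (f 0) _ (f (suc (suc B))))

sumTo-truncate : ∀ M B (f : ℕ → ℚ) → M ℕ.≤ B → (∀ j → M ℕ.< j → f j ≡ 0ℚ) → sumTo B f ≡ sumTo M f
sumTo-truncate M zero    f z≤n       f≡0 = refl
sumTo-truncate M (suc B) f M≤1+B f≡0 with ℕP.m≤n⇒m<n∨m≡n M≤1+B
... | inj₂ refl        = refl
... | inj₁ (s≤s M≤B) =
  trans (cong₂ _+_ (sumTo-truncate M B f M≤B f≡0) (f≡0 (suc B) (s≤s M≤B))) (ℚP.+-identityʳ _)

sumTo-comm : ∀ A B (f : ℕ → ℕ → ℚ) →
  sumTo A (λ i → sumTo B (λ j → f i j)) ≡ sumTo B (λ j → sumTo A (λ i → f i j))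
sumTo-comm zero    B f = refl
sumTo-comm (suc A) B f = trans (cong (_+ sumTo B (f (suc A))) (sumTo-comm A B f))
  (sym (sumTo-distrib-+ B (λ j → sumTo A (λ i → f i j)) (f (suc A))))

sumTo-*-factorˡ : ∀ B b (c f : ℕ → ℚ) → sumTo B (λ j → c j * (b * f j)) ≡ b * sumTo B (λ j → c j * f j)
sumTo-*-factorˡ B b c f = trans
  (sumTo-cong B (λ j _ → solve 3 (λ c b f → c :* (b :* f) := b :* (c :* f)) refl (c j) b (f j)))
  (sumTo-*ˡ B b _)
  where open +-*-Solver

sumTo-weighted-comm : ∀ A B (c u v : ℕ → ℚ) (f : ℕ → ℕ → ℚ) →
  sumTo A (λ j → c j * sumTo B (λ m → u m * f j m * v m))
    ≡ sumTo B (λ m → u m * sumTo A (λ j → c j * f j m) * v m)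
sumTo-weighted-comm A B c u v f = begin
  sumTo A (λ j → c j * sumTo B (λ m → u m * f j m * v m))
    ≡⟨ sumTo-cong A (λ j _ → sym (sumTo-*ˡ B (c j) _)) ⟩
  sumTo A (λ j → sumTo B (λ m → c j * (u m * f j m * v m)))
    ≡⟨ sumTo-comm A B _ ⟩
  sumTo B (λ m → sumTo A (λ j → c j * (u m * f j m * v m)))
    ≡⟨ sumTo-cong B (λ m _ → trans (sumTo-cong A (λ j _ → rearrange j m)) (sumTo-*ˡ A (u m * v m) _)) ⟩
  sumTo B (λ m → u m * v m * sumTo A (λ j → c j * f j m))
    ≡⟨ sumTo-cong B (λ m _ → solve 3 (λ u v s → u :* v :* s := u :* s :* v) refl (u m) (v m) _) ⟩
  sumTo B (λ m → u m * sumTo A (λ j → c j * f j m) * v m) ∎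
  where
    open ≡-Reasoning
    open +-*-Solver
    rearrange : ∀ j m → c j * (u m * f j m * v m) ≡ u m * v m * (c j * f j m)
    rearrange j m = solve 4 (λ c u f v → c :* (u :* f :* v) := u :* v :* (c :* f)) refl (c j) (u m) (f j m) (v m)

sumBox-cong : ∀ k B {f g : Vec ℕ k → ℚ} → (∀ v → f v ≡ g v) → sumBox k B f ≡ sumBox k B g
sumBox-cong zero    B f≗g = f≗g []
sumBox-cong (suc k) B f≗g = sumTo-cong B (λ j _ → sumBox-cong k B (λ v → f≗g (j ∷ v)))

sumBox-*ˡ : ∀ k B c (f : Vec ℕ k → ℚ) → sumBox k B (λ v → c * f v) ≡ c * sumBox k B f
sumBox-*ˡ zero    B c f = refl
sumBox-*ˡ (suc k) B c f =
  trans (sumTo-cong B (λ j _ → sumBox-*ˡ k B c (λ v → f (j ∷ v)))) (sumTo-*ˡ B c _)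

sumBox-factor : ∀ k B c {f g : Vec ℕ k → ℚ} → (∀ v → f v ≡ c * g v) → sumBox k B f ≡ c * sumBox k B g
sumBox-factor k B c {g = g} f≗cg = trans (sumBox-cong k B f≗cg) (sumBox-*ˡ k B c g)

prodFrom-suc : ∀ a len f → prodFrom (suc a) len f ≡ prodFrom a len (λ i → f (suc i))
prodFrom-suc a zero      f = refl
prodFrom-suc a (suc len) f = cong (f (suc a) *_) (prodFrom-suc (suc a) len f)

prodFrom-cong : ∀ a len {f g} → (∀ i → a ℕ.≤ i → f i ≡ g i) → prodFrom a len f ≡ prodFrom a len g
prodFrom-cong a zero      f≗g = refl
prodFrom-cong a (suc len) f≗g =
  cong₂ _*_ (f≗g a ℕP.≤-refl) (prodFrom-cong (suc a) len (λ i a<i → f≗g i (ℕP.<⇒≤ a<i)))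

prodFrom-suc-cong : ∀ a len {f g} → (∀ i → a ℕ.≤ i → f (suc i) ≡ g i) → prodFrom (suc a) len f ≡ prodFrom a len g
prodFrom-suc-cong a len f≗g = trans (prodFrom-suc a len _) (prodFrom-cong a len f≗g)

prodFrom-snoc : ∀ a len f → prodFrom a (suc len) f ≡ prodFrom a len f * f (a ℕ.+ len)
prodFrom-snoc a zero      f = trans (ℚP.*-identityʳ (f a))
  (trans (sym (ℚP.*-identityˡ (f a))) (cong (λ i → 1ℚ * f i) (sym (ℕP.+-identityʳ a))))
prodFrom-snoc a (suc len) f = trans (cong (f a *_) (prodFrom-snoc (suc a) len f))
  (trans (sym (ℚP.*-assoc (f a) _ _)) (cong (λ i → f a * prodFrom (suc a) len f * f i) (sym (ℕP.+-suc a len))))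

module _ (q : ℚ) where

  private
    sumℕ1 : ℕ → (ℕ → ℕ) → ℕ
    sumℕ1 zero    g = 0
    sumℕ1 (suc K) g = sumℕ1 K g ℕ.+ g (suc K)

    sumℤ1-pos : ∀ K {f : ℕ → ℤ} {g : ℕ → ℕ} → (∀ i → f i ≡ + g i) → sumℤ1 K f ≡ + sumℕ1 K g
    sumℤ1-pos zero    f≗g = refl
    sumℤ1-pos (suc K) f≗g = cong₂ ℤ._+_ (sumℤ1-pos K f≗g) (f≗g (suc K))

    ^ℕ-sumℕ1 : ∀ K g → q ^ℕ sumℕ1 K g ≡ prod1 K (λ i → q ^ℕ g i)
    ^ℕ-sumℕ1 zero    g = refl
    ^ℕ-sumℕ1 (suc K) g = trans (^ℕ-distribˡ-+-* q (sumℕ1 K g) (g (suc K)))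
      (trans (cong (_* q ^ℕ g (suc K)) (^ℕ-sumℕ1 K g)) (sym (prodFrom-snoc 1 K (λ i → q ^ℕ g i))))

  ^ℤ-sumℤ1 : ∀ K {f : ℕ → ℤ} (g : ℕ → ℕ) → (∀ i → f i ≡ + g i) → q ^ℤ sumℤ1 K f ≡ prod1 K (λ i → q ^ℕ g i)
  ^ℤ-sumℤ1 K g f≗g = trans (cong (q ^ℤ_) (sumℤ1-pos K f≗g)) (^ℕ-sumℕ1 K g)


tri : ℕ → ℕ
tri zero    = 0
tri (suc x) = tri x ℕ.+ suc x

triangle : ℤ → ℕ
triangle (+ x)    = tri x
triangle -[1+ x ] = tri x

triangle-suc : ∀ y → + triangle (y ℤ.+ + 1) ≡ + triangle y ℤ.+ y ℤ.+ + 1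
triangle-suc (+ x) = begin
  + tri (x ℕ.+ 1)          ≡⟨ cong (λ k → + tri k) (ℕP.+-comm x 1) ⟩
  + (tri x ℕ.+ suc x)      ≡⟨ ℤP.pos-+ (tri x) (suc x) ⟩
  + tri x ℤ.+ + suc x      ≡⟨ ring (+ tri x) (+ x) ⟩
  + tri x ℤ.+ + x ℤ.+ + 1  ∎
  where
    open ≡-Reasoning
    ring : ∀ t x → t ℤ.+ (+ 1 ℤ.+ x) ≡ t ℤ.+ x ℤ.+ + 1
    ring = solve-∀
triangle-suc -[1+ zero ]  = refl
triangle-suc -[1+ suc x ] = begin
  + tri x                                     ≡⟨ ring (+ tri x) (+ x) ⟩
  + tri x ℤ.+ (+ 1 ℤ.+ + x) ℤ.+ ℤ.- (+ 2 ℤ.+ + x) ℤ.+ + 1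
                                              ≡⟨ cong (λ k → k ℤ.+ -[1+ suc x ] ℤ.+ + 1) (sym (ℤP.pos-+ (tri x) (suc x))) ⟩
  + (tri x ℕ.+ suc x) ℤ.+ -[1+ suc x ] ℤ.+ + 1  ∎
  where
    open ≡-Reasoning
    ring : ∀ t x → t ≡ t ℤ.+ (+ 1 ℤ.+ x) ℤ.+ ℤ.- (+ 2 ℤ.+ x) ℤ.+ + 1
    ring = solve-∀

tri-double : ∀ x → + tri x ℤ.+ + tri x ≡ + x ℤ.* (+ x ℤ.+ + 1)
tri-double zero    = refl
tri-double (suc x) = begin
  + (tri x ℕ.+ suc x) ℤ.+ + (tri x ℕ.+ suc x)
    ≡⟨ cong₂ ℤ._+_ (ℤP.pos-+ (tri x) (suc x)) (ℤP.pos-+ (tri x) (suc x)) ⟩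
  (+ tri x ℤ.+ (+ 1 ℤ.+ + x)) ℤ.+ (+ tri x ℤ.+ (+ 1 ℤ.+ + x))
    ≡⟨ ring₁ (+ tri x) (+ x) ⟩
  (+ tri x ℤ.+ + tri x) ℤ.+ + 2 ℤ.* (+ 1 ℤ.+ + x)
    ≡⟨ cong (ℤ._+ + 2 ℤ.* (+ 1 ℤ.+ + x)) (tri-double x) ⟩
  + x ℤ.* (+ x ℤ.+ + 1) ℤ.+ + 2 ℤ.* (+ 1 ℤ.+ + x)
    ≡⟨ ring₂ (+ x) ⟩
  (+ 1 ℤ.+ + x) ℤ.* ((+ 1 ℤ.+ + x) ℤ.+ + 1)
    ∎
  where
    open ≡-Reasoning
    ring₁ : ∀ t x → (t ℤ.+ (+ 1 ℤ.+ x)) ℤ.+ (t ℤ.+ (+ 1 ℤ.+ x)) ≡ (t ℤ.+ t) ℤ.+ + 2 ℤ.* (+ 1 ℤ.+ x)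
    ring₁ = solve-∀
    ring₂ : ∀ x → x ℤ.* (x ℤ.+ + 1) ℤ.+ + 2 ℤ.* (+ 1 ℤ.+ x) ≡ (+ 1 ℤ.+ x) ℤ.* ((+ 1 ℤ.+ x) ℤ.+ + 1)
    ring₂ = solve-∀
triangle-double : ∀ y → + triangle y ℤ.+ + triangle y ≡ y ℤ.* (y ℤ.+ + 1)
triangle-double (+ x)    = tri-double x
triangle-double -[1+ x ] = trans (tri-double x) (ring (+ x))
  where
    ring : ∀ x → x ℤ.* (x ℤ.+ + 1) ≡ ℤ.- (+ 1 ℤ.+ x) ℤ.* (ℤ.- (+ 1 ℤ.+ x) ℤ.+ + 1)
    ring = solve-∀

private
  pos-+₃ : ∀ a b c → + (a ℕ.+ b ℕ.+ c) ≡ + a ℤ.+ + b ℤ.+ + c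
  pos-+₃ a b c = trans (ℤP.pos-+ (a ℕ.+ b) c) (cong (ℤ._+ + c) (ℤP.pos-+ a b))

  double-injective : ∀ x y → x ℤ.+ x ≡ y ℤ.+ y → x ≡ y
  double-injective x y 2x≡2y = ℤP.*-cancelˡ-≡ (+ 2) x y (trans (ring x) (trans 2x≡2y (sym (ring y))))
    where
      ring : ∀ x → + 2 ℤ.* x ≡ x ℤ.+ x
      ring = solve-∀

sum-of-triangles : ∀ x y z e → x ℤ.* (x ℤ.+ + 1) ℤ.+ y ℤ.* (y ℤ.+ + 1) ℤ.+ z ℤ.* (z ℤ.+ + 1) ≡ e ℤ.+ e
                 → + (triangle x ℕ.+ triangle y ℕ.+ triangle z) ≡ e
sum-of-triangles x y z e eq = double-injective _ e (begin
  S ℤ.+ S                                                        ≡⟨ cong₂ ℤ._+_ (pos-+₃ Tx Ty Tz) (pos-+₃ Tx Ty Tz) ⟩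
  (+ Tx ℤ.+ + Ty ℤ.+ + Tz) ℤ.+ (+ Tx ℤ.+ + Ty ℤ.+ + Tz)         ≡⟨ ring (+ Tx) (+ Ty) (+ Tz) ⟩
  (+ Tx ℤ.+ + Tx) ℤ.+ (+ Ty ℤ.+ + Ty) ℤ.+ (+ Tz ℤ.+ + Tz)
    ≡⟨ cong₂ ℤ._+_ (cong₂ ℤ._+_ (triangle-double x) (triangle-double y)) (triangle-double z) ⟩
  x ℤ.* (x ℤ.+ + 1) ℤ.+ y ℤ.* (y ℤ.+ + 1) ℤ.+ z ℤ.* (z ℤ.+ + 1)  ≡⟨ eq ⟩
  e ℤ.+ e                                                        ∎)
  where
    open ≡-Reasoning
    Tx = triangle x
    Ty = triangle y
    Tz = triangle z
    S = + (Tx ℕ.+ Ty ℕ.+ Tz)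
    ring : ∀ a b c → (a ℤ.+ b ℤ.+ c) ℤ.+ (a ℤ.+ b ℤ.+ c) ≡ (a ℤ.+ a) ℤ.+ (b ℤ.+ b) ℤ.+ (c ℤ.+ c)
    ring = solve-∀

-- The exponents n² − nm + m² (e⁺) and n² + nm + m² (e⁻) as sums of triangular numbers, kept in ℕ:
-- q may be 0, and then q ^ℤ is not multiplicative.
eK : ℤ → ℕ → ℕ
eK n m = triangle (+ m ℤ.- n) ℕ.+ triangle (+ m ℤ.- + 1)

e⁺ : ℕ → ℕ → ℕ
e⁺ n m = eK (+ n) m ℕ.+ triangle (+ n)

e⁻ : ℕ → ℕ → ℕ
e⁻ n m = eK (ℤ.- + n) m ℕ.+ triangle (+ n ℤ.- + 1)

ex-+1 : ∀ n m → ex (+ 1) n m ≡ + e⁺ n m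
ex-+1 n m = sym (sum-of-triangles (+ m ℤ.- + n) (+ m ℤ.- + 1) (+ n) _ (ring (+ n) (+ m)))
  where
    ring : ∀ n m → (m ℤ.- n) ℤ.* (m ℤ.- n ℤ.+ + 1) ℤ.+ (m ℤ.- + 1) ℤ.* (m ℤ.- + 1 ℤ.+ + 1) ℤ.+ n ℤ.* (n ℤ.+ + 1)
                 ≡ (n ℤ.* n ℤ.- + 1 ℤ.* (n ℤ.* m) ℤ.+ m ℤ.* m) ℤ.+ (n ℤ.* n ℤ.- + 1 ℤ.* (n ℤ.* m) ℤ.+ m ℤ.* m)
    ring = solve-∀

ex--1 : ∀ n m → ex -[1+ 0 ] n m ≡ + e⁻ n m
ex--1 n m = sym (sum-of-triangles (+ m ℤ.- ℤ.- + n) (+ m ℤ.- + 1) (+ n ℤ.- + 1) _ (ring (+ n) (+ m)))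
  where
    ring : ∀ n m → (m ℤ.- ℤ.- n) ℤ.* (m ℤ.- ℤ.- n ℤ.+ + 1) ℤ.+ (m ℤ.- + 1) ℤ.* (m ℤ.- + 1 ℤ.+ + 1)
                     ℤ.+ (n ℤ.- + 1) ℤ.* (n ℤ.- + 1 ℤ.+ + 1)
                 ≡ (n ℤ.* n ℤ.- -[1+ 0 ] ℤ.* (n ℤ.* m) ℤ.+ m ℤ.* m) ℤ.+ (n ℤ.* n ℤ.- -[1+ 0 ] ℤ.* (n ℤ.* m) ℤ.+ m ℤ.* m)
    ring = solve-∀

e⁻-zero : ∀ n → e⁻ n 0 ≡ n ℕ.* n
e⁻-zero n = ℤP.+-injective (trans (sum-of-triangles (+ 0 ℤ.- ℤ.- + n) (+ 0 ℤ.- + 1) (+ n ℤ.- + 1) _ (ring (+ n))) (sym (ℤP.pos-* n n)))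
  where
    ring : ∀ n → (+ 0 ℤ.- ℤ.- n) ℤ.* (+ 0 ℤ.- ℤ.- n ℤ.+ + 1) ℤ.+ (+ 0 ℤ.- + 1) ℤ.* (+ 0 ℤ.- + 1 ℤ.+ + 1)
                   ℤ.+ (n ℤ.- + 1) ℤ.* (n ℤ.- + 1 ℤ.+ + 1)
                 ≡ n ℤ.* n ℤ.+ n ℤ.* n
    ring = solve-∀

eK-sucʳ : ∀ n m M → m ℕ.≤ M → eK n (suc m) ℕ.+ (M ∸ m) ≡ M ℕ.+ eK (n ℤ.- + 1) m
eK-sucʳ n m M m≤M = begin
  triangle (+ suc m ℤ.- n) ℕ.+ tri m ℕ.+ (M ∸ m)
    ≡⟨ cong₂ (λ a b → a ℕ.+ b ℕ.+ (M ∸ m)) (cong triangle (ring (+ m) n)) (tri≡triangle-pred+ m) ⟩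
  A ℕ.+ (T ℕ.+ m) ℕ.+ (M ∸ m)
    ≡⟨ ringℕ A T m (M ∸ m) ⟩
  (m ℕ.+ (M ∸ m)) ℕ.+ (A ℕ.+ T)
    ≡⟨ cong (ℕ._+ (A ℕ.+ T)) (ℕP.m+[n∸m]≡n m≤M) ⟩
  M ℕ.+ (A ℕ.+ T)
    ∎
  where
    open ≡-Reasoning
    A = triangle (+ m ℤ.- (n ℤ.- + 1))
    T = triangle (+ m ℤ.- + 1)
    ring : ∀ m n → + 1 ℤ.+ m ℤ.- n ≡ m ℤ.- (n ℤ.- + 1)
    ring = solve-∀
    ringℕ : ∀ a t m d → a ℕ.+ (t ℕ.+ m) ℕ.+ d ≡ (m ℕ.+ d) ℕ.+ (a ℕ.+ t)
    ringℕ = ℕ-Ring.solve-∀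
    tri≡triangle-pred+ : ∀ m → tri m ≡ triangle (+ m ℤ.- + 1) ℕ.+ m
    tri≡triangle-pred+ zero    = refl
    tri≡triangle-pred+ (suc m) = refl

eK-shift : ∀ n m c x → + x ≡ + suc c ℤ.- n ℤ.+ + m → eK n m ℕ.+ x ≡ c ℕ.+ eK (n ℤ.- + 1) m
eK-shift n m c x x≡ = ℤP.+-injective (begin
  + (triangle y ℕ.+ T ℕ.+ x)
    ≡⟨ pos-+₃ (triangle y) T x ⟩
  + triangle y ℤ.+ + T ℤ.+ + x
    ≡⟨ cong (λ k → + triangle y ℤ.+ + T ℤ.+ k) x≡ ⟩
  + triangle y ℤ.+ + T ℤ.+ (+ suc c ℤ.- n ℤ.+ + m)
    ≡⟨ ring (+ triangle y) (+ T) (+ c) n (+ m) ⟩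
  + c ℤ.+ (+ triangle y ℤ.+ (+ m ℤ.- n) ℤ.+ + 1) ℤ.+ + T
    ≡⟨ cong (λ k → + c ℤ.+ k ℤ.+ + T) (sym (triangle-suc y)) ⟩
  + c ℤ.+ + triangle (+ m ℤ.- n ℤ.+ + 1) ℤ.+ + T
    ≡⟨ cong (λ k → + c ℤ.+ + triangle k ℤ.+ + T) (ring′ (+ m) n) ⟩
  + c ℤ.+ + triangle (+ m ℤ.- (n ℤ.- + 1)) ℤ.+ + T
    ≡⟨ pos-+₃ c _ T ⟨
  + (c ℕ.+ triangle (+ m ℤ.- (n ℤ.- + 1)) ℕ.+ T)
    ≡⟨ cong +_ (ℕP.+-assoc c _ T) ⟩
  + (c ℕ.+ eK (n ℤ.- + 1) m)
    ∎)
  where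
    open ≡-Reasoning
    y = + m ℤ.- n
    T = triangle (+ m ℤ.- + 1)
    ring : ∀ t T c n m → t ℤ.+ T ℤ.+ (+ 1 ℤ.+ c ℤ.- n ℤ.+ m) ≡ c ℤ.+ (t ℤ.+ (m ℤ.- n) ℤ.+ + 1) ℤ.+ T
    ring = solve-∀
    ring′ : ∀ m n → m ℤ.- n ℤ.+ + 1 ≡ m ℤ.- (n ℤ.- + 1)
    ring′ = solve-∀


module QBinomial (q : ℚ) where

  qb : ℕ → ℕ → ℚ
  qb n m = qbinom q (+ n) (+ m)

  1/poch : ℤ → ℚ
  1/poch = invPoch q

  qb-≡0 : ∀ {n m} → n ℕ.< m → qb n m ≡ 0ℚ
  qb-≡0 {n} {m} n<m with m ℕ.≤? n
  ... | yes m≤n = ⊥-elim (ℕP.<⇒≱ n<m m≤n)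
  ... | no  _   = refl

  qb-*-cong : ∀ n m {x y} → (m ℕ.≤ n → x ≡ y) → qb n m * x ≡ qb n m * y
  qb-*-cong n m {x} {y} eq = by-cases (m ℕ.≤? n)
    where
      by-cases : Dec (m ℕ.≤ n) → qb n m * x ≡ qb n m * y
      by-cases (yes m≤n) = cong (qb n m *_) (eq m≤n)
      by-cases (no  m≰n) = zeroˡ-cong x y (qb-≡0 (ℕP.≰⇒> m≰n))

  sumTo-*qb-truncate : ∀ {M B} (w : ℕ → ℚ) → M ℕ.≤ B →
    sumTo B (λ m → w m * qb M m) ≡ sumTo M (λ m → w m * qb M m)
  sumTo-*qb-truncate {M} {B} w M≤B =
    sumTo-truncate M B _ M≤B (λ m M<m → trans (cong (w m *_) (qb-≡0 M<m)) (ℚP.*-zeroʳ (w m)))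

  module Nonvanishing (q≢1 : q ≢ 1ℚ) (q≢-1 : q ≢ - 1ℚ) where

    private
      poch-prod≢0 : ∀ m k → poch q m * poch q k ≢ 0ℚ
      poch-prod≢0 m k = *-≢0 (poch≢0 q q≢1 q≢-1 m) (poch≢0 q q≢1 q≢-1 k)

    qb-*-poch : ∀ {n m} → m ℕ.≤ n → qb n m * (poch q m * poch q (n ∸ m)) ≡ poch q n
    qb-*-poch {n} {m} m≤n with m ℕ.≤? n
    ... | no  m≰n = ⊥-elim (m≰n m≤n)
    ... | yes _   = x/d*d≡x (poch q n) (poch-prod≢0 m (n ∸ m))

    qb-unique : ∀ n m x → m ℕ.≤ n → x * (poch q m * poch q (n ∸ m)) ≡ poch q n → qb n m ≡ x
    qb-unique n m x m≤n eq =
      *-cancelʳ-≢0 _ _ (poch-prod≢0 m (n ∸ m)) (trans (qb-*-poch m≤n) (sym eq))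

    qb-n-0 : ∀ n → qb n 0 ≡ 1ℚ
    qb-n-0 n = qb-unique n 0 1ℚ z≤n (trans (ℚP.*-identityˡ _) (ℚP.*-identityˡ _))

    qb-n-n : ∀ n → qb n n ≡ 1ℚ
    qb-n-n n = qb-unique n n 1ℚ ℕP.≤-refl (begin
      1ℚ * (poch q n * poch q (n ∸ n))  ≡⟨ ℚP.*-identityˡ _ ⟩
      poch q n * poch q (n ∸ n)         ≡⟨ cong (λ k → poch q n * poch q k) (ℕP.n∸n≡0 n) ⟩
      poch q n * 1ℚ                     ≡⟨ ℚP.*-identityʳ _ ⟩
      poch q n                          ∎)
      where open ≡-Reasoning

    qb-pascal : ∀ N j → qb (suc N) (suc j) ≡ qb N (suc j) + q ^ℕ (N ∸ j) * qb N j
    qb-pascal N j with ℕ.<-cmp j N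
    ... | tri≈ _ refl _ = begin
      qb (suc N) (suc N)                     ≡⟨ qb-n-n (suc N) ⟩
      0ℚ + 1ℚ * 1ℚ                           ≡⟨ cong₂ (λ a b → a + q ^ℕ 0 * b) (sym (qb-≡0 (ℕP.n<1+n N))) (sym (qb-n-n N)) ⟩
      qb N (suc N) + q ^ℕ 0 * qb N N         ≡⟨ cong (λ k → qb N (suc N) + q ^ℕ k * qb N N) (sym (ℕP.n∸n≡0 N)) ⟩
      qb N (suc N) + q ^ℕ (N ∸ N) * qb N N   ∎
      where open ≡-Reasoning
    ... | tri> _ _ N<j = begin
      qb (suc N) (suc j)                      ≡⟨ qb-≡0 (s≤s N<j) ⟩
      0ℚ                                      ≡⟨ solve 1 (λ x → con 0ℚ := con 0ℚ :+ x :* con 0ℚ) refl (q ^ℕ (N ∸ j)) ⟩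
      0ℚ + q ^ℕ (N ∸ j) * 0ℚ                   ≡⟨ cong₂ (λ a b → a + q ^ℕ (N ∸ j) * b)
                                                         (sym (qb-≡0 (ℕP.<-trans N<j (ℕP.n<1+n j)))) (sym (qb-≡0 N<j)) ⟩
      qb N (suc j) + q ^ℕ (N ∸ j) * qb N j    ∎
      where open ≡-Reasoning
            open +-*-Solver
    ... | tri< j<N _ _ = qb-unique (suc N) (suc j) _ (s≤s (ℕP.<⇒≤ j<N)) (begin
        (X + A * Y) * (pj * (1ℚ - C) * poch q (N ∸ j))
          ≡⟨ cong (λ t → (X + A * Y) * (pj * (1ℚ - C) * t)) poch-N∸j ⟩
        (X + A * Y) * (pj * (1ℚ - C) * (p' * (1ℚ - A)))
          ≡⟨ solve 6 (λ X A Y pj C p' → (X :+ A :* Y) :* (pj :* (con 1ℚ :- C) :* (p' :* (con 1ℚ :- A)))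
                     := X :* (pj :* (con 1ℚ :- C) :* p') :* (con 1ℚ :- A) :+ A :* (con 1ℚ :- C) :* (Y :* (pj :* (p' :* (con 1ℚ :- A)))))
                     refl X A Y pj C p' ⟩
        X * (pj * (1ℚ - C) * p') * (1ℚ - A) + A * (1ℚ - C) * (Y * (pj * (p' * (1ℚ - A))))
          ≡⟨ cong₂ (λ u v → u * (1ℚ - A) + A * (1ℚ - C) * v)
                   (qb-*-poch j<N) (trans (cong (λ t → Y * (pj * t)) (sym poch-N∸j)) (qb-*-poch (ℕP.<⇒≤ j<N))) ⟩
        P * (1ℚ - A) + A * (1ℚ - C) * P
          ≡⟨ solve 3 (λ P A C → P :* (con 1ℚ :- A) :+ A :* (con 1ℚ :- C) :* P := P :* (con 1ℚ :- A :* C)) refl P A C ⟩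
        P * (1ℚ - A * C)
          ≡⟨ cong (λ t → P * (1ℚ - t)) (trans (sym (^ℕ-distribˡ-+-* q (N ∸ j) (suc j))) (cong (q ^ℕ_) N∸j+1+j≡1+N)) ⟩
        poch q (suc N) ∎)
      where
        open ≡-Reasoning
        open +-*-Solver
        X = qb N (suc j)
        Y = qb N j
        A = q ^ℕ (N ∸ j)
        C = q ^ℕ suc j
        P = poch q N
        pj = poch q j
        p' = poch q (N ∸ suc j)
        N∸j≡1+N∸1+j : N ∸ j ≡ suc (N ∸ suc j)
        N∸j≡1+N∸1+j = ℕP.+-∸-assoc 1 j<N
        poch-N∸j : poch q (N ∸ j) ≡ p' * (1ℚ - A)
        poch-N∸j = subst (λ k → poch q k ≡ p' * (1ℚ - q ^ℕ k)) (sym N∸j≡1+N∸1+j) refl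
        N∸j+1+j≡1+N : N ∸ j ℕ.+ suc j ≡ suc N
        N∸j+1+j≡1+N = trans (ℕP.+-suc (N ∸ j) j) (cong suc (ℕP.m∸n+n≡m (ℕP.<⇒≤ j<N)))

    1/poch-pascal : ∀ x → 1/poch (+ x) ≡ 1/poch (+ x ℤ.- + 1) + q ^ℕ x * 1/poch (+ x)
    1/poch-pascal zero    = refl
    1/poch-pascal (suc y) = *-cancelʳ-≢0 _ _ d≢0 (begin
        inv d * d                        ≡⟨ inv-inverseˡ d d≢0 ⟩
        1ℚ                               ≡⟨ solve 1 (λ s → con 1ℚ := con 1ℚ :* (con 1ℚ :- s) :+ s :* con 1ℚ) refl s ⟩
        1ℚ * c + s * 1ℚ                  ≡⟨ cong₂ (λ u v → u * c + s * v) (sym (inv-inverseˡ P P≢0)) (sym (inv-inverseˡ d d≢0)) ⟩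
        inv P * P * c + s * (inv d * d)  ≡⟨ solve 5 (λ iP P c s id → iP :* P :* c :+ s :* (id :* (P :* c)) := (iP :+ s :* id) :* (P :* c))
                                                    refl (inv P) P c s (inv d) ⟩
        (inv P + s * inv d) * d          ∎)
      where
        open ≡-Reasoning
        open +-*-Solver
        P = poch q y
        s = q ^ℕ suc y
        c = 1ℚ - s
        d = P * c
        P≢0 = poch≢0 q q≢1 q≢-1 y
        d≢0 = *-≢0 P≢0 (1-^ℕ-suc≢0 q q≢1 q≢-1 y)

    sumTo-qb-pascal : ∀ N (w : ℕ → ℚ) →
      sumTo (suc N) (λ m → w m * qb (suc N) m)
        ≡ sumTo N (λ m → w m * qb N m) + sumTo N (λ m → w (suc m) * (q ^ℕ (N ∸ m) * qb N m))
    sumTo-qb-pascal N w = begin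
      sumTo (suc N) (λ m → w m * qb (suc N) m)
        ≡⟨ sumTo-suc N _ ⟩
      w 0 * qb (suc N) 0 + sumTo N (λ m → w (suc m) * qb (suc N) (suc m))
        ≡⟨ cong₂ _+_ (cong (w 0 *_) (trans (qb-n-0 (suc N)) (sym (qb-n-0 N))))
                     (sumTo-cong N (λ m _ → trans (cong (w (suc m) *_) (qb-pascal N m)) (ℚP.*-distribˡ-+ (w (suc m)) _ _))) ⟩
      w 0 * qb N 0 + sumTo N (λ m → w (suc m) * qb N (suc m) + w (suc m) * (q ^ℕ (N ∸ m) * qb N m))
        ≡⟨ cong (λ t → w 0 * qb N 0 + t) (sumTo-distrib-+ N _ _) ⟩
      w 0 * qb N 0 + (sumTo N (λ m → w (suc m) * qb N (suc m)) + S)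
        ≡⟨ ℚP.+-assoc (w 0 * qb N 0) (sumTo N (λ m → w (suc m) * qb N (suc m))) S ⟨
      w 0 * qb N 0 + sumTo N (λ m → w (suc m) * qb N (suc m)) + S
        ≡⟨ cong (_+ S) (sumTo-suc N (λ m → w m * qb N m)) ⟨
      sumTo (suc N) (λ m → w m * qb N m) + S
        ≡⟨ cong (_+ S) (sumTo-*qb-truncate w (ℕP.n≤1+n N)) ⟩
      sumTo N (λ m → w m * qb N m) + S
        ∎
      where
        open ≡-Reasoning
        S = sumTo N (λ m → w (suc m) * (q ^ℕ (N ∸ m) * qb N m))


module Kernel (q : ℚ) (q≢1 : q ≢ 1ℚ) (q≢-1 : q ≢ - 1ℚ) where
  open QBinomial q
  open Nonvanishing q≢1 q≢-1

  kernel : ℤ → ℕ → ℕ → ℚ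
  kernel n M c = sumTo M (λ m → q ^ℕ eK n m * 1/poch (+ c ℤ.- n ℤ.+ + m) * qb M m)

  private
    ^ℕ-+-cong : ∀ a b c d → a ℕ.+ b ≡ c ℕ.+ d → q ^ℕ a * q ^ℕ b ≡ q ^ℕ c * q ^ℕ d
    ^ℕ-+-cong a b c d eq =
      trans (sym (^ℕ-distribˡ-+-* q a b)) (trans (cong (q ^ℕ_) eq) (^ℕ-distribˡ-+-* q c d))

    ring-shift : ∀ c n m → c ℤ.- n ℤ.+ (+ 1 ℤ.+ m) ≡ c ℤ.- (n ℤ.- + 1) ℤ.+ m
    ring-shift = solve-∀

  kernel-sucˡ : ∀ n M c → kernel n (suc M) c ≡ kernel n M c + q ^ℕ M * kernel (n ℤ.- + 1) M c
  kernel-sucˡ n M c = begin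
    kernel n (suc M) c
      ≡⟨ sumTo-qb-pascal M w ⟩
    kernel n M c + sumTo M (λ m → w (suc m) * (q ^ℕ (M ∸ m) * qb M m))
      ≡⟨ cong (λ t → kernel n M c + t) (sumTo-cong M (λ m m≤M → term m m≤M)) ⟩
    kernel n M c + sumTo M (λ m → q ^ℕ M * (w′ m * qb M m))
      ≡⟨ cong (λ t → kernel n M c + t) (sumTo-*ˡ M (q ^ℕ M) _) ⟩
    kernel n M c + q ^ℕ M * kernel (n ℤ.- + 1) M c
      ∎
    where
      open ≡-Reasoning
      open +-*-Solver
      w  = λ m → q ^ℕ eK n m * 1/poch (+ c ℤ.- n ℤ.+ + m)
      w′ = λ m → q ^ℕ eK (n ℤ.- + 1) m * 1/poch (+ c ℤ.- (n ℤ.- + 1) ℤ.+ + m)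
      term : ∀ m → m ℕ.≤ M → w (suc m) * (q ^ℕ (M ∸ m) * qb M m) ≡ q ^ℕ M * (w′ m * qb M m)
      term m m≤M = begin
        q ^ℕ eK n (suc m) * I * (q ^ℕ (M ∸ m) * qb M m)
          ≡⟨ solve 4 (λ a i b x → a :* i :* (b :* x) := a :* b :* i :* x) refl (q ^ℕ eK n (suc m)) I (q ^ℕ (M ∸ m)) (qb M m) ⟩
        q ^ℕ eK n (suc m) * q ^ℕ (M ∸ m) * I * qb M m
          ≡⟨ cong₂ (λ e i → e * i * qb M m) (^ℕ-+-cong (eK n (suc m)) (M ∸ m) M (eK (n ℤ.- + 1) m) (eK-sucʳ n m M m≤M))
                                             (cong 1/poch (ring-shift (+ c) n (+ m))) ⟩
        q ^ℕ M * q ^ℕ eK (n ℤ.- + 1) m * 1/poch (+ c ℤ.- (n ℤ.- + 1) ℤ.+ + m) * qb M m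
          ≡⟨ trans (cong (_* qb M m) (ℚP.*-assoc (q ^ℕ M) _ _)) (ℚP.*-assoc (q ^ℕ M) (w′ m) (qb M m)) ⟩
        q ^ℕ M * (w′ m * qb M m)
          ∎
        where I = 1/poch (+ c ℤ.- n ℤ.+ + suc m)

  private
    1/poch-split : ∀ E E′ c (X : ℤ) → (∀ x → X ≡ + x → E ℕ.+ x ≡ c ℕ.+ E′) →
      q ^ℕ E * 1/poch X ≡ q ^ℕ E * 1/poch (X ℤ.- + 1) + q ^ℕ c * (q ^ℕ E′ * 1/poch X)
    1/poch-split E E′ c (+ x) exp = begin
      q ^ℕ E * 1/poch (+ x)
        ≡⟨ cong (q ^ℕ E *_) (1/poch-pascal x) ⟩
      q ^ℕ E * (1/poch (+ x ℤ.- + 1) + q ^ℕ x * 1/poch (+ x))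
        ≡⟨ solve 4 (λ e i s j → e :* (i :+ s :* j) := e :* i :+ e :* s :* j) refl (q ^ℕ E) (1/poch (+ x ℤ.- + 1)) (q ^ℕ x) (1/poch (+ x)) ⟩
      q ^ℕ E * 1/poch (+ x ℤ.- + 1) + q ^ℕ E * q ^ℕ x * 1/poch (+ x)
        ≡⟨ cong (λ t → q ^ℕ E * 1/poch (+ x ℤ.- + 1) + t * 1/poch (+ x)) (^ℕ-+-cong E x c E′ (exp x refl)) ⟩
      q ^ℕ E * 1/poch (+ x ℤ.- + 1) + q ^ℕ c * q ^ℕ E′ * 1/poch (+ x)
        ≡⟨ cong (λ t → q ^ℕ E * 1/poch (+ x ℤ.- + 1) + t) (ℚP.*-assoc (q ^ℕ c) _ _) ⟩
      q ^ℕ E * 1/poch (+ x ℤ.- + 1) + q ^ℕ c * (q ^ℕ E′ * 1/poch (+ x))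
        ∎
      where open ≡-Reasoning
            open +-*-Solver
    1/poch-split E E′ c -[1+ x ] _ =
      solve 3 (λ e s e′ → e :* con 0ℚ := e :* con 0ℚ :+ s :* (e′ :* con 0ℚ)) refl (q ^ℕ E) (q ^ℕ c) (q ^ℕ E′)
      where open +-*-Solver

  kernel-sucʳ : ∀ n M c → kernel n M (suc c) ≡ kernel n M c + q ^ℕ c * kernel (n ℤ.- + 1) M c
  kernel-sucʳ n M c = begin
    kernel n M (suc c)
      ≡⟨ sumTo-cong M (λ m _ → trans (cong (_* qb M m) (split m)) (distrib m)) ⟩
    sumTo M (λ m → t m + q ^ℕ c * t′ m)
      ≡⟨ sumTo-distrib-+ M t _ ⟩
    kernel n M c + sumTo M (λ m → q ^ℕ c * t′ m)
      ≡⟨ cong (λ t → kernel n M c + t) (sumTo-*ˡ M (q ^ℕ c) t′) ⟩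
    kernel n M c + q ^ℕ c * kernel (n ℤ.- + 1) M c
      ∎
    where
      open ≡-Reasoning
      open +-*-Solver
      w  = λ m → q ^ℕ eK n m * 1/poch (+ c ℤ.- n ℤ.+ + m)
      w′ = λ m → q ^ℕ eK (n ℤ.- + 1) m * 1/poch (+ c ℤ.- (n ℤ.- + 1) ℤ.+ + m)
      t  = λ m → w m * qb M m
      t′ = λ m → w′ m * qb M m
      ring₁ : ∀ c n m → + 1 ℤ.+ c ℤ.- n ℤ.+ m ℤ.- + 1 ≡ c ℤ.- n ℤ.+ m
      ring₁ = solve-∀
      ring₂ : ∀ c n m → + 1 ℤ.+ c ℤ.- n ℤ.+ m ≡ c ℤ.- (n ℤ.- + 1) ℤ.+ m
      ring₂ = solve-∀
      split : ∀ m → q ^ℕ eK n m * 1/poch (+ suc c ℤ.- n ℤ.+ + m) ≡ w m + q ^ℕ c * w′ m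
      split m = trans (1/poch-split (eK n m) (eK (n ℤ.- + 1) m) c _ (λ x X≡x → eK-shift n m c x (sym X≡x)))
        (cong₂ (λ a b → q ^ℕ eK n m * 1/poch a + q ^ℕ c * (q ^ℕ eK (n ℤ.- + 1) m * 1/poch b))
               (ring₁ (+ c) n (+ m)) (ring₂ (+ c) n (+ m)))
      distrib : ∀ m → (w m + q ^ℕ c * w′ m) * qb M m ≡ t m + q ^ℕ c * t′ m
      distrib m = solve 4 (λ a s b y → (a :+ s :* b) :* y := a :* y :+ s :* (b :* y)) refl (w m) (q ^ℕ c) (w′ m) (qb M m)

  kernel-sym : ∀ M c n → kernel n M c ≡ kernel n c M
  kernel-sym zero    zero    n = refl
  kernel-sym zero    (suc c) n = trans (kernel-sucʳ n 0 c)
    (trans (cong₂ (λ a b → a + q ^ℕ c * b) (kernel-sym 0 c n) (kernel-sym 0 c (n ℤ.- + 1))) (sym (kernel-sucˡ n c 0)))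
  kernel-sym (suc M) c       n = trans (kernel-sucˡ n M c)
    (trans (cong₂ (λ a b → a + q ^ℕ M * b) (kernel-sym M c n) (kernel-sym M c (n ℤ.- + 1))) (sym (kernel-sucʳ n c M)))


pos-∸ : ∀ {n a} → a ℕ.≤ n → + (n ∸ a) ≡ + n ℤ.- + a
pos-∸ {n} {a} a≤n = sym (trans (ℤP.m-n≡m⊖n n a) (ℤP.⊖-≥ a≤n))

∸-+-≤-double : ∀ {n a b} → a ℕ.≤ n → b ℕ.≤ 2 ℕ.* a → n ∸ a ℕ.+ b ℕ.≤ 2 ℕ.* n
∸-+-≤-double {n} {a} {b} a≤n b≤2a = begin
  n ∸ a ℕ.+ b          ≤⟨ ℕP.+-monoʳ-≤ (n ∸ a) b≤2a ⟩
  n ∸ a ℕ.+ 2 ℕ.* a    ≡⟨ cong (λ k → n ∸ a ℕ.+ (a ℕ.+ k)) (ℕP.+-identityʳ a) ⟩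
  n ∸ a ℕ.+ (a ℕ.+ a)  ≡⟨ ℕP.+-assoc (n ∸ a) a a ⟨
  n ∸ a ℕ.+ a ℕ.+ a    ≡⟨ cong (ℕ._+ a) (ℕP.m∸n+n≡m a≤n) ⟩
  n ℕ.+ a              ≤⟨ ℕP.+-monoʳ-≤ n a≤n ⟩
  n ℕ.+ n              ≡⟨ cong (n ℕ.+_) (ℕP.+-identityʳ n) ⟨
  2 ℕ.* n              ∎
  where open ℕP.≤-Reasoning

module Nested (q : ℚ) (B : ℕ) where
  open QBinomial q

  weight : ℕ → ℕ → ℕ → ℚ
  weight M n m = 1/poch (+ M ℤ.- + n ℤ.+ + m)

  link : ℕ → ℕ → ℕ → ℕ → ℚ
  link n m n′ m′ = qbinom q (+ n ℤ.- + n′ ℤ.+ + m′) (+ m)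

  link≡qb : ∀ {n m n′ m′} → n′ ℕ.≤ n → link n m n′ m′ ≡ qb (n ∸ n′ ℕ.+ m′) m
  link≡qb n′≤n = cong (λ k → qbinom q (k ℤ.+ _) _) (sym (pos-∸ n′≤n))

  link-≡0 : ∀ {n m n′ m′} → n′ ℕ.≤ n → m′ ℕ.≤ 2 ℕ.* n′ → 2 ℕ.* n ℕ.< m → link n m n′ m′ ≡ 0ℚ
  link-≡0 n′≤n m′≤2n′ 2n<m = trans (link≡qb n′≤n) (qb-≡0 (ℕP.≤-<-trans (∸-+-≤-double n′≤n m′≤2n′) 2n<m))

  -- For n₀ = np, m₀ = M and fixed (n₁,…,n_k) = nv: the sum over m₁,…,m_k of the summand of F as
  -- nested sums; e is the exponent of the innermost layer (e⁺ for a = 1, e⁻ for a = −1).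
  Fₘ : (ℕ → ℕ → ℕ) → ℕ → ℕ → ∀ {K} → Vec ℕ (suc K) → ℚ
  Fₘ e np M (n ∷ [])      = qb np n * sumTo B (λ m → q ^ℕ e n m * 1/poch (+ n ℤ.+ + m) * qb M m)
  Fₘ e np M (n ∷ n′ ∷ ns) = qb np n * sumTo B (λ m → q ^ℕ e⁺ n m * qb M m * Fₘ e n m (n′ ∷ ns))

  -- The innermost layer of a right-hand side as a functional of the weight h (cap⁺, cap⁻ below).
  -- It reads h only at m ≤ 2n, which keeps every use of kernel-transform inside the truncation.
  record Boundary : Set where
    field
      cap        : ℕ → (ℕ → ℕ → ℚ) → ℚ
      cap-zero   : ∀ n → cap n (λ _ _ → 0ℚ) ≡ 0ℚ
      cap-local  : ∀ n {h h′} → (∀ m → m ℕ.≤ 2 ℕ.* n → h n m ≡ h′ n m) → cap n h ≡ cap n h′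
      cap-linear : ∀ n (c : ℕ → ℚ) (hs : ℕ → ℕ → ℕ → ℚ) →
                   sumTo B (λ j → c j * cap n (hs j)) ≡ cap n (λ a b → sumTo B (λ j → c j * hs j a b))

  Innermost : (ℕ → ℕ → ℕ) → Boundary → Set
  Innermost e L = ∀ n M → 2 ℕ.* n ℕ.≤ B → M ℕ.≤ B →
    sumTo B (λ m → q ^ℕ e n m * 1/poch (+ n ℤ.+ + m) * qb M m) ≡ Boundary.cap L n (weight M)

  module _ (L : Boundary) where
    open Boundary L

    -- The analogue of Fₘ for a right-hand side, with 1/(q)_(m₀−n₁+m₁) generalised to h n₁ m₁.
    Rₘ : ℕ → (ℕ → ℕ → ℚ) → ∀ {K} → Vec ℕ (suc K) → ℚ
    Rₘ np h (n ∷ [])      = qb np n * cap n h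
    Rₘ np h (n ∷ n′ ∷ ns) = qb np n * sumTo B (λ m → q ^ℕ e⁺ n m * h n m * Rₘ n (link n m) (n′ ∷ ns))

    Rₘ-zero : ∀ {K} np (nv : Vec ℕ (suc K)) → Rₘ np (λ _ _ → 0ℚ) nv ≡ 0ℚ
    Rₘ-zero np (n ∷ [])      = trans (cong (qb np n *_) (cap-zero n)) (ℚP.*-zeroʳ (qb np n))
    Rₘ-zero np (n ∷ n′ ∷ ns) = trans (cong (qb np n *_) (trans (sumTo-cong B term≡0) (sumTo-zero B))) (ℚP.*-zeroʳ (qb np n))
      where
        open +-*-Solver
        term≡0 : ∀ m → m ℕ.≤ B → q ^ℕ e⁺ n m * 0ℚ * Rₘ n (link n m) (n′ ∷ ns) ≡ 0ℚ
        term≡0 m _ = solve 2 (λ e r → e :* con 0ℚ :* r := con 0ℚ) refl (q ^ℕ e⁺ n m) (Rₘ n (link n m) (n′ ∷ ns))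

    Rₘ-local : ∀ {K} np (nv : Vec ℕ (suc K)) {h h′} →
      (∀ n m → n ℕ.≤ np → m ℕ.≤ 2 ℕ.* n → h n m ≡ h′ n m) → Rₘ np h nv ≡ Rₘ np h′ nv
    Rₘ-local np (n ∷ [])      h≗h′ = qb-*-cong np n (λ n≤np → cap-local n (λ m → h≗h′ n m n≤np))
    Rₘ-local np (n ∷ n′ ∷ ns) {h} {h′} h≗h′ = qb-*-cong np n (λ n≤np → sumTo-cong B (λ m _ → term n≤np m (m ℕ.≤? 2 ℕ.* n)))
      where
        R = λ m → Rₘ n (link n m) (n′ ∷ ns)
        term : n ℕ.≤ np → ∀ m → Dec (m ℕ.≤ 2 ℕ.* n) → q ^ℕ e⁺ n m * h n m * R m ≡ q ^ℕ e⁺ n m * h′ n m * R m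
        term n≤np m (yes m≤2n) = cong (λ x → q ^ℕ e⁺ n m * x * R m) (h≗h′ n m n≤np m≤2n)
        term n≤np m (no  m≰2n) = zeroʳ-cong (q ^ℕ e⁺ n m * h n m) (q ^ℕ e⁺ n m * h′ n m) (trans
          (Rₘ-local n (n′ ∷ ns) (λ a b a≤n b≤2a → link-≡0 a≤n b≤2a (ℕP.≰⇒> m≰2n)))
          (Rₘ-zero n (n′ ∷ ns)))

    Rₘ-linear : ∀ {K} np (c : ℕ → ℚ) (hs : ℕ → ℕ → ℕ → ℚ) (nv : Vec ℕ (suc K)) →
      sumTo B (λ j → c j * Rₘ np (hs j) nv) ≡ Rₘ np (λ a b → sumTo B (λ j → c j * hs j a b)) nv
    Rₘ-linear np c hs (n ∷ []) =
      trans (sumTo-*-factorˡ B (qb np n) c (λ j → cap n (hs j))) (cong (qb np n *_) (cap-linear n c hs))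
    Rₘ-linear np c hs (n ∷ n′ ∷ ns) =
      trans (sumTo-*-factorˡ B (qb np n) c (λ j → sumTo B (λ m → q ^ℕ e⁺ n m * hs j n m * R m)))
            (cong (qb np n *_) (sumTo-weighted-comm B B c (λ m → q ^ℕ e⁺ n m) R (λ j m → hs j n m)))
      where
        R = λ m → Rₘ n (link n m) (n′ ∷ ns)

  cap⁺ : ℕ → (ℕ → ℕ → ℚ) → ℚ
  cap⁺ n h = sumTo B (λ m → q ^ℕ e⁺ n m * h n m * qb (2 ℕ.* n) m)

  boundary⁺ : Boundary
  boundary⁺ = record
    { cap        = cap⁺
    ; cap-zero   = λ n → trans (sumTo-cong B (λ m _ → zero-term n m)) (sumTo-zero B)
    ; cap-local  = λ n {h} {h′} h≗h′ → sumTo-cong B (λ m _ → local n {h} {h′} h≗h′ m (m ℕ.≤? 2 ℕ.* n))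
    ; cap-linear = λ n c hs → sumTo-weighted-comm B B c (λ m → q ^ℕ e⁺ n m) (qb (2 ℕ.* n)) (λ j m → hs j n m)
    }
    where
      open +-*-Solver
      zero-term : ∀ n m → q ^ℕ e⁺ n m * 0ℚ * qb (2 ℕ.* n) m ≡ 0ℚ
      zero-term n m = solve 2 (λ e b → e :* con 0ℚ :* b := con 0ℚ) refl (q ^ℕ e⁺ n m) (qb (2 ℕ.* n) m)
      local : ∀ n {h h′} → (∀ m → m ℕ.≤ 2 ℕ.* n → h n m ≡ h′ n m) → ∀ m → Dec (m ℕ.≤ 2 ℕ.* n) →
              q ^ℕ e⁺ n m * h n m * qb (2 ℕ.* n) m ≡ q ^ℕ e⁺ n m * h′ n m * qb (2 ℕ.* n) m
      local n h≗h′ m (yes m≤2n) = cong (λ x → q ^ℕ e⁺ n m * x * qb (2 ℕ.* n) m) (h≗h′ m m≤2n)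
      local n {h} {h′} h≗h′ m (no  m≰2n) =
        zeroʳ-cong (q ^ℕ e⁺ n m * h n m) (q ^ℕ e⁺ n m * h′ n m) (qb-≡0 (ℕP.≰⇒> m≰2n))

  cap⁻ : ℕ → (ℕ → ℕ → ℚ) → ℚ
  cap⁻ n h = q ^ℕ (n ℕ.* n) * h n (2 ℕ.* n)

  boundary⁻ : Boundary
  boundary⁻ = record
    { cap        = cap⁻
    ; cap-zero   = λ n → ℚP.*-zeroʳ (q ^ℕ (n ℕ.* n))
    ; cap-local  = λ n h≗h′ → cong (q ^ℕ (n ℕ.* n) *_) (h≗h′ (2 ℕ.* n) ℕP.≤-refl)
    ; cap-linear = λ n c hs → sumTo-*-factorˡ B (q ^ℕ (n ℕ.* n)) c (λ j → hs j n (2 ℕ.* n))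
    }

  module _ (q≢1 : q ≢ 1ℚ) (q≢-1 : q ≢ - 1ℚ) where
    open Nonvanishing q≢1 q≢-1
    open Kernel q q≢1 q≢-1

    sumTo-kernel : ∀ n t M c → M ℕ.≤ B →
      sumTo B (λ m → q ^ℕ (eK n m ℕ.+ t) * 1/poch (+ c ℤ.- n ℤ.+ + m) * qb M m) ≡ q ^ℕ t * kernel n M c
    sumTo-kernel n t M c M≤B = begin
      sumTo B (λ m → q ^ℕ (eK n m ℕ.+ t) * I m * qb M m)
        ≡⟨ sumTo-*qb-truncate (λ m → q ^ℕ (eK n m ℕ.+ t) * I m) M≤B ⟩
      sumTo M (λ m → q ^ℕ (eK n m ℕ.+ t) * I m * qb M m)
        ≡⟨ sumTo-cong M (λ m _ → split m) ⟩
      sumTo M (λ m → q ^ℕ t * (q ^ℕ eK n m * I m * qb M m))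
        ≡⟨ sumTo-*ˡ M (q ^ℕ t) _ ⟩
      q ^ℕ t * kernel n M c ∎
      where
        open ≡-Reasoning
        open +-*-Solver
        I = λ m → 1/poch (+ c ℤ.- n ℤ.+ + m)
        split : ∀ m → q ^ℕ (eK n m ℕ.+ t) * I m * qb M m ≡ q ^ℕ t * (q ^ℕ eK n m * I m * qb M m)
        split m = trans (cong (λ x → x * I m * qb M m) (^ℕ-distribˡ-+-* q (eK n m) t))
          (solve 4 (λ a b i x → a :* b :* i :* x := b :* (a :* i :* x)) refl (q ^ℕ eK n m) (q ^ℕ t) (I m) (qb M m))

    kernel-transform : ∀ n M c → M ℕ.≤ B → c ℕ.≤ B →
      sumTo B (λ m → q ^ℕ e⁺ n m * 1/poch (+ c ℤ.- + n ℤ.+ + m) * qb M m)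
        ≡ sumTo B (λ m → q ^ℕ e⁺ n m * 1/poch (+ M ℤ.- + n ℤ.+ + m) * qb c m)
    kernel-transform n M c M≤B c≤B =
      trans (sumTo-kernel (+ n) t M c M≤B)
        (trans (cong (q ^ℕ t *_) (kernel-sym M c (+ n))) (sym (sumTo-kernel (+ n) t c M c≤B)))
      where t = triangle (+ n)

    innermost⁺ : Innermost e⁺ boundary⁺
    innermost⁺ n M 2n≤B M≤B =
      trans (sumTo-cong B (λ m _ → cong (λ x → q ^ℕ e⁺ n m * 1/poch x * qb M m) (arg m)))
            (kernel-transform n M (2 ℕ.* n) M≤B 2n≤B)
      where
        ring : ∀ n m → n ℤ.+ m ≡ + 2 ℤ.* n ℤ.- n ℤ.+ m
        ring = solve-∀
        arg : ∀ m → + n ℤ.+ + m ≡ + (2 ℕ.* n) ℤ.- + n ℤ.+ + m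
        arg m = trans (ring (+ n) (+ m)) (cong (λ k → k ℤ.- + n ℤ.+ + m) (sym (ℤP.pos-* 2 n)))

    innermost⁻ : Innermost e⁻ boundary⁻
    innermost⁻ n M _ M≤B = begin
      sumTo B (λ m → q ^ℕ e⁻ n m * 1/poch (+ n ℤ.+ + m) * qb M m)
        ≡⟨ sumTo-cong B (λ m _ → cong (λ x → q ^ℕ e⁻ n m * 1/poch x * qb M m) (ring₁ (+ n) (+ m))) ⟩
      sumTo B (λ m → q ^ℕ (eK (ℤ.- + n) m ℕ.+ t) * 1/poch (+ 0 ℤ.- ℤ.- + n ℤ.+ + m) * qb M m)
        ≡⟨ sumTo-kernel (ℤ.- + n) t M 0 M≤B ⟩
      q ^ℕ t * kernel (ℤ.- + n) M 0
        ≡⟨ cong (q ^ℕ t *_) (kernel-sym M 0 (ℤ.- + n)) ⟩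
      q ^ℕ t * (q ^ℕ eK (ℤ.- + n) 0 * I * qb 0 0)
        ≡⟨ cong (λ x → q ^ℕ t * (q ^ℕ eK (ℤ.- + n) 0 * I * x)) (qb-n-0 0) ⟩
      q ^ℕ t * (q ^ℕ eK (ℤ.- + n) 0 * I * 1ℚ)
        ≡⟨ solve 3 (λ t e i → t :* (e :* i :* con 1ℚ) := e :* t :* i) refl (q ^ℕ t) (q ^ℕ eK (ℤ.- + n) 0) I ⟩
      q ^ℕ eK (ℤ.- + n) 0 * q ^ℕ t * I
        ≡⟨ cong₂ _*_ (trans (sym (^ℕ-distribˡ-+-* q (eK (ℤ.- + n) 0) t)) (cong (q ^ℕ_) (e⁻-zero n))) (cong 1/poch arg) ⟩
      q ^ℕ (n ℕ.* n) * 1/poch (+ M ℤ.- + n ℤ.+ + (2 ℕ.* n)) ∎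
      where
        open ≡-Reasoning
        open +-*-Solver
        t = triangle (+ n ℤ.- + 1)
        I = 1/poch (+ M ℤ.- ℤ.- + n ℤ.+ + 0)
        ring₁ : ∀ n m → n ℤ.+ m ≡ + 0 ℤ.- ℤ.- n ℤ.+ m
        ring₁ = solve-∀
        ring₂ : ∀ M n → M ℤ.- ℤ.- n ℤ.+ + 0 ≡ M ℤ.- n ℤ.+ + 2 ℤ.* n
        ring₂ = solve-∀
        arg : + M ℤ.- ℤ.- + n ℤ.+ + 0 ≡ + M ℤ.- + n ℤ.+ + (2 ℕ.* n)
        arg = trans (ring₂ (+ M) (+ n)) (cong (λ k → + M ℤ.- + n ℤ.+ k) (sym (ℤP.pos-* 2 n)))

    kernel-transform-step : ∀ n M a b → a ℕ.≤ n → b ℕ.≤ 2 ℕ.* a → 2 ℕ.* n ℕ.≤ B → M ℕ.≤ B →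
      sumTo B (λ j → q ^ℕ e⁺ n j * qb M j * weight j a b) ≡ sumTo B (λ j → q ^ℕ e⁺ n j * weight M n j * link n j a b)
    kernel-transform-step n M a b a≤n b≤2a 2n≤B M≤B = begin
      sumTo B (λ j → q ^ℕ e⁺ n j * qb M j * weight j a b)
        ≡⟨ sumTo-cong B (λ j _ → trans (swap j) (cong (λ x → q ^ℕ e⁺ n j * 1/poch x * qb M j) (arg j))) ⟩
      sumTo B (λ j → q ^ℕ e⁺ n j * 1/poch (+ c ℤ.- + n ℤ.+ + j) * qb M j)
        ≡⟨ kernel-transform n M c M≤B (ℕP.≤-trans (∸-+-≤-double a≤n b≤2a) 2n≤B) ⟩
      sumTo B (λ j → q ^ℕ e⁺ n j * weight M n j * qb c j)
        ≡⟨ sumTo-cong B (λ j _ → cong (q ^ℕ e⁺ n j * weight M n j *_) (sym (link≡qb a≤n))) ⟩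
      sumTo B (λ j → q ^ℕ e⁺ n j * weight M n j * link n j a b) ∎
      where
        open ≡-Reasoning
        open +-*-Solver
        c = n ∸ a ℕ.+ b
        swap : ∀ j → q ^ℕ e⁺ n j * qb M j * weight j a b ≡ q ^ℕ e⁺ n j * weight j a b * qb M j
        swap j = solve 3 (λ e x y → e :* x :* y := e :* y :* x) refl (q ^ℕ e⁺ n j) (qb M j) (weight j a b)
        ring : ∀ j a b n → j ℤ.- a ℤ.+ b ≡ (n ℤ.- a) ℤ.+ b ℤ.- n ℤ.+ j
        ring = solve-∀
        arg : ∀ j → + j ℤ.- + a ℤ.+ + b ≡ + c ℤ.- + n ℤ.+ + j
        arg j = trans (ring (+ j) (+ a) (+ b) (+ n))
          (cong (λ k → k ℤ.- + n ℤ.+ + j) (sym (trans (ℤP.pos-+ (n ∸ a) b) (cong (ℤ._+ + b) (pos-∸ a≤n)))))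

    Fₘ≡Rₘ : ∀ e L → Innermost e L →
      ∀ {K} (nv : Vec ℕ (suc K)) np M → 2 ℕ.* np ℕ.≤ B → M ℕ.≤ B → Fₘ e np M nv ≡ Rₘ L np (weight M) nv
    Fₘ≡Rₘ e L innermost (n ∷ []) np M 2np≤B M≤B =
      qb-*-cong np n (λ n≤np → innermost n M (ℕP.≤-trans (ℕP.*-monoʳ-≤ 2 n≤np) 2np≤B) M≤B)
    Fₘ≡Rₘ e L innermost (n ∷ n′ ∷ ns) np M 2np≤B M≤B = qb-*-cong np n λ n≤np →
      let 2n≤B = ℕP.≤-trans (ℕP.*-monoʳ-≤ 2 n≤np) 2np≤B in begin
      sumTo B (λ j → c j * Fₘ e n j (n′ ∷ ns))
        ≡⟨ sumTo-cong B (λ j j≤B → cong (c j *_) (Fₘ≡Rₘ e L innermost (n′ ∷ ns) n j 2n≤B j≤B)) ⟩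
      sumTo B (λ j → c j * Rₘ L n (weight j) (n′ ∷ ns))
        ≡⟨ Rₘ-linear L n c weight (n′ ∷ ns) ⟩
      Rₘ L n (λ a b → sumTo B (λ j → c j * weight j a b)) (n′ ∷ ns)
        ≡⟨ Rₘ-local L n (n′ ∷ ns) (λ a b a≤n b≤2a → kernel-transform-step n M a b a≤n b≤2a 2n≤B M≤B) ⟩
      Rₘ L n (λ a b → sumTo B (λ j → d j * link n j a b)) (n′ ∷ ns)
        ≡⟨ Rₘ-linear L n d (link n) (n′ ∷ ns) ⟨
      sumTo B (λ j → d j * Rₘ L n (link n j) (n′ ∷ ns)) ∎
      where
        open ≡-Reasoning
        c = λ j → q ^ℕ e⁺ n j * qb M j
        d = λ j → q ^ℕ e⁺ n j * weight M n j


seq-suc : ∀ d x (l : List ℕ) i → seq d (x ∷ₗ l) (suc i) ≡ seq x l i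
seq-suc d x l zero    = refl
seq-suc d x l (suc i) = refl

module Conversion (q : ℚ) (B : ℕ) where
  open QBinomial q
  open Nested q B

  -- The factors of the products in Ftr, Rplus and Rminus, verbatim, so that they unfold to them.
  F-factor : ℤ → ℕ → (ℕ → ℕ) → (ℕ → ℕ) → ℕ → ℚ
  F-factor a k n m i = (q ^ℤ ex (sig a k i) (n i) (m i))
                       * qbinom q (ι (n (ℕ.pred i))) (ι (n i)) * qbinom q (ι (m (ℕ.pred i))) (ι (m i))

  F-factor-shift : ∀ a k d x e y (l l′ : List ℕ) i → 1 ℕ.≤ i →
    F-factor a (suc k) (seq d (x ∷ₗ l)) (seq e (y ∷ₗ l′)) (suc i) ≡ F-factor a k (seq x l) (seq y l′) i
  F-factor-shift a k d x e y l l′ (suc zero)    _ = refl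
  F-factor-shift a k d x e y l l′ (suc (suc i)) _ = refl

  sumBox-F : ∀ a (e : ℕ → ℕ → ℕ) → (∀ n m → q ^ℤ ex a n m ≡ q ^ℕ e n m) → ∀ {K} d M (nv : Vec ℕ (suc K)) →
    sumBox (suc K) B (λ mv → invPoch q (ι (seq d (toList nv) (suc K)) ℤ.+ ι (seq M (toList mv) (suc K)))
                             * prod1 (suc K) (F-factor a (suc K) (seq d (toList nv)) (seq M (toList mv))))
      ≡ Fₘ e d M nv
  sumBox-F a e qᵉ d M (x ∷ []) =
    trans (sumTo-cong B (λ j _ → term j)) (sumTo-*ˡ B (qb d x) _)
    where
      open +-*-Solver
      term : ∀ j → 1/poch (+ x ℤ.+ + j) * (q ^ℤ ex a x j * qb d x * qb M j * 1ℚ)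
                   ≡ qb d x * (q ^ℕ e x j * 1/poch (+ x ℤ.+ + j) * qb M j)
      term j = trans (cong (λ t → 1/poch (+ x ℤ.+ + j) * (t * qb d x * qb M j * 1ℚ)) (qᵉ x j))
        (solve 4 (λ i E b c → i :* (E :* b :* c :* con 1ℚ) := b :* (E :* i :* c)) refl
           (1/poch (+ x ℤ.+ + j)) (q ^ℕ e x j) (qb d x) (qb M j))
  sumBox-F a e qᵉ {suc K} d M (x ∷ x′ ∷ xs) = begin
    sumTo B (λ j → sumBox (suc K) B (λ v → I j v * (F-factor a (suc (suc K)) N (seq M (j ∷ₗ toList v)) 1
                                                    * prodFrom 2 (suc K) (F-factor a (suc (suc K)) N (seq M (j ∷ₗ toList v))))))
      ≡⟨ sumTo-cong B (λ j _ → sumBox-factor (suc K) B (qb d x * (q ^ℕ e⁺ x j * qb M j)) (term j)) ⟩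
    sumTo B (λ j → qb d x * (q ^ℕ e⁺ x j * qb M j) * sumBox (suc K) B (λ v → I j v * P j v))
      ≡⟨ sumTo-cong B (λ j _ → cong (qb d x * (q ^ℕ e⁺ x j * qb M j) *_) (sumBox-F a e qᵉ x j (x′ ∷ xs))) ⟩
    sumTo B (λ j → qb d x * (q ^ℕ e⁺ x j * qb M j) * Fₘ e x j (x′ ∷ xs))
      ≡⟨ sumTo-cong B (λ j _ → ℚP.*-assoc (qb d x) _ _) ⟩
    sumTo B (λ j → qb d x * (q ^ℕ e⁺ x j * qb M j * Fₘ e x j (x′ ∷ xs)))
      ≡⟨ sumTo-*ˡ B (qb d x) _ ⟩
    Fₘ e d M (x ∷ x′ ∷ xs) ∎
    where
      open ≡-Reasoning
      open +-*-Solver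
      N = seq d (toList (x ∷ x′ ∷ xs))
      I = λ j (v : Vec ℕ (suc K)) → invPoch q (ι (seq x (toList (x′ ∷ xs)) (suc K)) ℤ.+ ι (seq j (toList v) (suc K)))
      P = λ j (v : Vec ℕ (suc K)) → prod1 (suc K) (F-factor a (suc K) (seq x (toList (x′ ∷ xs))) (seq j (toList v)))
      term : ∀ j v → I j v * (F-factor a (suc (suc K)) N (seq M (j ∷ₗ toList v)) 1
                              * prodFrom 2 (suc K) (F-factor a (suc (suc K)) N (seq M (j ∷ₗ toList v))))
                     ≡ qb d x * (q ^ℕ e⁺ x j * qb M j) * (I j v * P j v)
      term j v = trans
        (cong₂ (λ E p → I j v * (E * qb d x * qb M j * p)) (cong (q ^ℤ_) (ex-+1 x j))
               (prodFrom-suc-cong 1 (suc K) {F-factor a (suc (suc K)) N (seq M (j ∷ₗ toList v))}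
                  (F-factor-shift a (suc K) d x M j (toList (x′ ∷ xs)) (toList v))))
        (solve 5 (λ i E b c p → i :* (E :* b :* c :* p) := b :* (E :* c) :* (i :* p)) refl
           (I j v) (q ^ℕ e⁺ x j) (qb d x) (qb M j) (P j v))

  G-factor : (ℕ → ℕ) → (ℕ → ℕ) → ℕ → ℚ
  G-factor n m i = qbinom q (ι (n i)) (ι (n (suc i))) * qbinom q (ι (n i) ℤ.- ι (n (suc i)) ℤ.+ ι (m (suc i))) (ι (m i))

  sumBox-R⁺ : ∀ {K} d M h (nv : Vec ℕ (suc K)) →
    sumBox (suc K) B (λ mv → let n = seq d (toList nv); m = seq M (toList mv) in
      prod1 (suc K) (λ i → q ^ℕ e⁺ (n i) (m i)) * h (n 1) (m 1) * qb d (n 1)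
      * qb (2 ℕ.* n (suc K)) (m (suc K)) * prod1 K (G-factor n m))
      ≡ Rₘ boundary⁺ d h nv
  sumBox-R⁺ d M h (x ∷ []) = trans (sumTo-cong B (λ j _ → term j)) (sumTo-*ˡ B (qb d x) _)
    where
      open +-*-Solver
      term : ∀ j → q ^ℕ e⁺ x j * 1ℚ * h x j * qb d x * qb (2 ℕ.* x) j * 1ℚ ≡ qb d x * (q ^ℕ e⁺ x j * h x j * qb (2 ℕ.* x) j)
      term j = solve 4 (λ E h b c → E :* con 1ℚ :* h :* b :* c :* con 1ℚ := b :* (E :* h :* c)) refl
                 (q ^ℕ e⁺ x j) (h x j) (qb d x) (qb (2 ℕ.* x) j)
  sumBox-R⁺ {suc K} d M h (x ∷ x′ ∷ xs) = begin
    sumTo B (λ j → sumBox (suc K) B (λ v → summand j v))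
      ≡⟨ sumTo-cong B (λ j _ → sumBox-factor (suc K) B (qb d x * (q ^ℕ e⁺ x j * h x j)) (term j)) ⟩
    sumTo B (λ j → qb d x * (q ^ℕ e⁺ x j * h x j) * sumBox (suc K) B (summand′ j))
      ≡⟨ sumTo-cong B (λ j _ → cong (qb d x * (q ^ℕ e⁺ x j * h x j) *_) (sumBox-R⁺ x j (link x j) (x′ ∷ xs))) ⟩
    sumTo B (λ j → qb d x * (q ^ℕ e⁺ x j * h x j) * Rₘ boundary⁺ x (link x j) (x′ ∷ xs))
      ≡⟨ sumTo-cong B (λ j _ → ℚP.*-assoc (qb d x) _ _) ⟩
    sumTo B (λ j → qb d x * (q ^ℕ e⁺ x j * h x j * Rₘ boundary⁺ x (link x j) (x′ ∷ xs)))
      ≡⟨ sumTo-*ˡ B (qb d x) _ ⟩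
    Rₘ boundary⁺ d h (x ∷ x′ ∷ xs) ∎
    where
      open ≡-Reasoning
      open +-*-Solver
      N = seq d (toList (x ∷ x′ ∷ xs))
      N′ = seq x (toList (x′ ∷ xs))
      summand : ℕ → Vec ℕ (suc K) → ℚ
      summand j v = let m = seq M (j ∷ₗ toList v) in
        prod1 (suc (suc K)) (λ i → q ^ℕ e⁺ (N i) (m i)) * h x j * qb d x
        * qb (2 ℕ.* N (suc (suc K))) (m (suc (suc K))) * prod1 (suc K) (G-factor N m)
      summand′ : ℕ → Vec ℕ (suc K) → ℚ
      summand′ j v = let m = seq j (toList v) in
        prod1 (suc K) (λ i → q ^ℕ e⁺ (N′ i) (m i)) * link x j x′ (m 1) * qb x x′
        * qb (2 ℕ.* N′ (suc K)) (m (suc K)) * prod1 K (G-factor N′ m)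
      term : ∀ j v → summand j v ≡ qb d x * (q ^ℕ e⁺ x j * h x j) * summand′ j v
      term j v = trans
        (cong₂ (λ PE PG → q ^ℕ e⁺ x j * PE * h x j * qb d x * L * (qb x x′ * link x j x′ (seq j (toList v) 1) * PG))
          (prodFrom-suc-cong 1 (suc K) {λ i → q ^ℕ e⁺ (N i) (seq M (j ∷ₗ toList v) i)}
             (λ i _ → cong₂ (λ a b → q ^ℕ e⁺ a b) (seq-suc d x (toList (x′ ∷ xs)) i) (seq-suc M j (toList v) i)))
          (prodFrom-suc-cong 1 K {G-factor N (seq M (j ∷ₗ toList v))} (λ { zero () ; (suc i) _ → refl })))
        (solve 8 (λ E PE h b L c k PG → E :* PE :* h :* b :* L :* (c :* k :* PG) := b :* (E :* h) :* (PE :* k :* c :* L :* PG)) refl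
           (q ^ℕ e⁺ x j) (prod1 (suc K) (λ i → q ^ℕ e⁺ (N′ i) (seq j (toList v) i))) (h x j) (qb d x) L
           (qb x x′) (link x j x′ (seq j (toList v) 1)) (prod1 K (G-factor N′ (seq j (toList v)))))
        where L = qb (2 ℕ.* N′ (suc K)) (seq j (toList v) (suc K))

  H-factor : (ℕ → ℕ) → (ℕ → ℕ) → ℕ → ℚ
  H-factor n m i = (q ^ℤ ex (+ 1) (n i) (m i)) * qbinom q (ι (n i)) (ι (n (suc i)))
                   * qbinom q (ι (n i) ℤ.- ι (n (suc i)) ℤ.+ ι (m (suc i))) (ι (m i))

  sumBox-R⁻ : ∀ {K} d M h (nv : Vec ℕ (suc K)) →
    sumBox K B (λ mv → let n = seq d (toList nv); m = seq M (toList mv ++ (2 ℕ.* n (suc K) ∷ₗ []ₗ)) in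
      q ^ℤ (ι (n (suc K)) ℤ.* ι (n (suc K))) * h (n 1) (m 1) * qb d (n 1) * prod1 K (H-factor n m))
      ≡ Rₘ boundary⁻ d h nv
  sumBox-R⁻ d M h (x ∷ []) =
    trans (cong (λ e → q ^ℤ e * h x (2 ℕ.* x) * qb d x * 1ℚ) (sym (ℤP.pos-* x x)))
      (solve 3 (λ Q h b → Q :* h :* b :* con 1ℚ := b :* (Q :* h)) refl (q ^ℕ (x ℕ.* x)) (h x (2 ℕ.* x)) (qb d x))
    where open +-*-Solver
  sumBox-R⁻ {suc K} d M h (x ∷ x′ ∷ xs) = begin
    sumTo B (λ j → sumBox K B (λ v → summand j v))
      ≡⟨ sumTo-cong B (λ j _ → sumBox-factor K B (qb d x * (q ^ℕ e⁺ x j * h x j)) (term j)) ⟩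
    sumTo B (λ j → qb d x * (q ^ℕ e⁺ x j * h x j) * sumBox K B (summand′ j))
      ≡⟨ sumTo-cong B (λ j _ → cong (qb d x * (q ^ℕ e⁺ x j * h x j) *_) (sumBox-R⁻ x j (link x j) (x′ ∷ xs))) ⟩
    sumTo B (λ j → qb d x * (q ^ℕ e⁺ x j * h x j) * Rₘ boundary⁻ x (link x j) (x′ ∷ xs))
      ≡⟨ sumTo-cong B (λ j _ → ℚP.*-assoc (qb d x) _ _) ⟩
    sumTo B (λ j → qb d x * (q ^ℕ e⁺ x j * h x j * Rₘ boundary⁻ x (link x j) (x′ ∷ xs)))
      ≡⟨ sumTo-*ˡ B (qb d x) _ ⟩
    Rₘ boundary⁻ d h (x ∷ x′ ∷ xs) ∎
    where
      open ≡-Reasoning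
      open +-*-Solver
      N = seq d (toList (x ∷ x′ ∷ xs))
      N′ = seq x (toList (x′ ∷ xs))
      S = N′ (suc K)
      Q = q ^ℤ (ι S ℤ.* ι S)
      m′ = λ j (v : Vec ℕ K) → seq j (toList v ++ (2 ℕ.* S ∷ₗ []ₗ))
      summand : ℕ → Vec ℕ K → ℚ
      summand j v = let m = seq M (j ∷ₗ toList v ++ (2 ℕ.* S ∷ₗ []ₗ)) in
        Q * h x j * qb d x * prod1 (suc K) (H-factor N m)
      summand′ : ℕ → Vec ℕ K → ℚ
      summand′ j v = Q * link x j x′ (m′ j v 1) * qb x x′ * prod1 K (H-factor N′ (m′ j v))
      term : ∀ j v → summand j v ≡ qb d x * (q ^ℕ e⁺ x j * h x j) * summand′ j v
      term j v = trans
        (cong₂ (λ E P → Q * h x j * qb d x * (E * qb x x′ * link x j x′ (m′ j v 1) * P))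
          (cong (q ^ℤ_) (ex-+1 x j))
          (prodFrom-suc-cong 1 K {H-factor N (seq M (j ∷ₗ toList v ++ (2 ℕ.* S ∷ₗ []ₗ)))} (λ { zero () ; (suc i) _ → refl })))
        (solve 7 (λ Q h b E c k P → Q :* h :* b :* (E :* c :* k :* P) := b :* (E :* h) :* (Q :* k :* c :* P)) refl
           Q (h x j) (qb d x) (q ^ℕ e⁺ x j) (qb x x′) (link x j x′ (m′ j v 1)) (prod1 K (H-factor N′ (m′ j v))))

  Ftr≡ΣFₘ : ∀ a e → (∀ n m → q ^ℤ ex a n m ≡ q ^ℕ e n m) → ∀ n0 m0 K z →
    Ftr a n0 m0 (suc K) z q B ≡ sumBox (suc K) B (λ nv → z ^ℕ seq n0 (toList nv) 1 * Fₘ e n0 m0 nv)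
  Ftr≡ΣFₘ a e qᵉ n0 m0 K z = sumBox-cong (suc K) B λ nv →
    let n = seq n0 (toList nv)
        I = λ (mv : Vec ℕ (suc K)) → invPoch q (ι (n (suc K)) ℤ.+ ι (seq m0 (toList mv) (suc K)))
        P = λ (mv : Vec ℕ (suc K)) → prod1 (suc K) (F-factor a (suc K) n (seq m0 (toList mv)))
    in trans (sumBox-factor (suc K) B (z ^ℕ n 1) (λ mv → ℚP.*-assoc (z ^ℕ n 1) (I mv) (P mv)))
             (cong (z ^ℕ n 1 *_) (sumBox-F a e qᵉ n0 m0 nv))

  Rplus≡ΣRₘ : ∀ n0 m0 K z →
    Rplus n0 m0 (suc K) z q B ≡ sumBox (suc K) B (λ nv → z ^ℕ seq n0 (toList nv) 1 * Rₘ boundary⁺ n0 (weight m0) nv)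
  Rplus≡ΣRₘ n0 m0 K z = sumBox-cong (suc K) B λ nv →
    trans (sumBox-factor (suc K) B (z ^ℕ seq n0 (toList nv) 1) (rearrange nv))
          (cong (z ^ℕ seq n0 (toList nv) 1 *_) (sumBox-R⁺ n0 m0 (weight m0) nv))
    where
      open +-*-Solver
      rearrange : ∀ (nv mv : Vec ℕ (suc K)) → let n = seq n0 (toList nv); m = seq m0 (toList mv) in
        z ^ℕ n 1 * (q ^ℤ sumℤ1 (suc K) (λ i → ex (+ 1) (n i) (m i))) * weight m0 (n 1) (m 1) * qb n0 (n 1)
          * qb (2 ℕ.* n (suc K)) (m (suc K)) * prod1 K (G-factor n m)
        ≡ z ^ℕ n 1 * (prod1 (suc K) (λ i → q ^ℕ e⁺ (n i) (m i)) * weight m0 (n 1) (m 1) * qb n0 (n 1)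
          * qb (2 ℕ.* n (suc K)) (m (suc K)) * prod1 K (G-factor n m))
      rearrange nv mv = let n = seq n0 (toList nv); m = seq m0 (toList mv) in
        trans (cong (λ E → z ^ℕ n 1 * E * weight m0 (n 1) (m 1) * qb n0 (n 1) * qb (2 ℕ.* n (suc K)) (m (suc K)) * prod1 K (G-factor n m))
                    (^ℤ-sumℤ1 q (suc K) (λ i → e⁺ (n i) (m i)) (λ i → ex-+1 (n i) (m i))))
          (solve 6 (λ Z E h b c G → Z :* E :* h :* b :* c :* G := Z :* (E :* h :* b :* c :* G)) refl
             (z ^ℕ n 1) (prod1 (suc K) (λ i → q ^ℕ e⁺ (n i) (m i))) (weight m0 (n 1) (m 1)) (qb n0 (n 1))
             (qb (2 ℕ.* n (suc K)) (m (suc K))) (prod1 K (G-factor n m)))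

  Rminus≡ΣRₘ : ∀ n0 m0 K z →
    Rminus n0 m0 (suc K) z q B ≡ sumBox (suc K) B (λ nv → z ^ℕ seq n0 (toList nv) 1 * Rₘ boundary⁻ n0 (weight m0) nv)
  Rminus≡ΣRₘ n0 m0 K z = sumBox-cong (suc K) B λ nv →
    trans (sumBox-factor K B (z ^ℕ seq n0 (toList nv) 1) (rearrange nv))
          (cong (z ^ℕ seq n0 (toList nv) 1 *_) (sumBox-R⁻ n0 m0 (weight m0) nv))
    where
      open +-*-Solver
      rearrange : ∀ (nv : Vec ℕ (suc K)) (mv : Vec ℕ K) →
        let n = seq n0 (toList nv); m = seq m0 (toList mv ++ (2 ℕ.* n (suc K) ∷ₗ []ₗ))
            Q = q ^ℤ (ι (n (suc K)) ℤ.* ι (n (suc K))) in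
        z ^ℕ n 1 * Q * weight m0 (n 1) (m 1) * qb n0 (n 1) * prod1 K (H-factor n m)
        ≡ z ^ℕ n 1 * (Q * weight m0 (n 1) (m 1) * qb n0 (n 1) * prod1 K (H-factor n m))
      rearrange nv mv =
        let n = seq n0 (toList nv); m = seq m0 (toList mv ++ (2 ℕ.* n (suc K) ∷ₗ []ₗ)) in
        solve 5 (λ Z Q h b P → Z :* Q :* h :* b :* P := Z :* (Q :* h :* b :* P)) refl
          (z ^ℕ n 1) (q ^ℤ (ι (n (suc K)) ℤ.* ι (n (suc K)))) (weight m0 (n 1) (m 1)) (qb n0 (n 1)) (prod1 K (H-factor n m))

proposition7p1 : (k : ℕ) → 1 ℕ.≤ k → (n0 m0 : ℕ) → (z q : ℚ) → q ≢ 1ℚ → q ≢ - 1ℚ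
    → (B : ℕ) → 2 ℕ.* (n0 ℕ.+ m0) ℕ.≤ B
    → (Ftr -[1+ 0 ] n0 m0 k z q B ≡ Rminus n0 m0 k z q B)
    × (Ftr (+ 1) n0 m0 k z q B ≡ Rplus n0 m0 k z q B)
proposition7p1 zero    ()
proposition7p1 (suc K) _ n0 m0 z q q≢1 q≢-1 B 2[n0+m0]≤B =
  (begin
    Ftr -[1+ 0 ] n0 m0 (suc K) z q B  ≡⟨ Ftr≡ΣFₘ -[1+ 0 ] e⁻ (λ n m → cong (q ^ℤ_) (ex--1 n m)) n0 m0 K z ⟩
    ΣF e⁻                             ≡⟨ ΣFₘ≡ΣRₘ e⁻ boundary⁻ (innermost⁻ q≢1 q≢-1) ⟩
    ΣR boundary⁻                      ≡⟨ Rminus≡ΣRₘ n0 m0 K z ⟨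
    Rminus n0 m0 (suc K) z q B        ∎)
  ,
  (begin
    Ftr (+ 1) n0 m0 (suc K) z q B     ≡⟨ Ftr≡ΣFₘ (+ 1) e⁺ (λ n m → cong (q ^ℤ_) (ex-+1 n m)) n0 m0 K z ⟩
    ΣF e⁺                             ≡⟨ ΣFₘ≡ΣRₘ e⁺ boundary⁺ (innermost⁺ q≢1 q≢-1) ⟩
    ΣR boundary⁺                      ≡⟨ Rplus≡ΣRₘ n0 m0 K z ⟨
    Rplus n0 m0 (suc K) z q B         ∎)
  where
    open ≡-Reasoning
    open Nested q B
    open Conversion q B
    2n0≤B : 2 ℕ.* n0 ℕ.≤ B
    2n0≤B = ℕP.≤-trans (ℕP.*-monoʳ-≤ 2 (ℕP.m≤m+n n0 m0)) 2[n0+m0]≤B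
    m0≤B : m0 ℕ.≤ B
    m0≤B = ℕP.≤-trans (ℕP.m≤n+m m0 n0) (ℕP.≤-trans (ℕP.m≤m+n (n0 ℕ.+ m0) _) 2[n0+m0]≤B)
    ΣF : (ℕ → ℕ → ℕ) → ℚ
    ΣF e = sumBox (suc K) B (λ nv → z ^ℕ seq n0 (toList nv) 1 * Fₘ e n0 m0 nv)
    ΣR : Boundary → ℚ
    ΣR L = sumBox (suc K) B (λ nv → z ^ℕ seq n0 (toList nv) 1 * Rₘ L n0 (weight m0) nv)
    ΣFₘ≡ΣRₘ : ∀ e L → Innermost e L → ΣF e ≡ ΣR L
    ΣFₘ≡ΣRₘ e L innermost = sumBox-cong (suc K) B (λ nv →
      cong (z ^ℕ seq n0 (toList nv) 1 *_) (Fₘ≡Rₘ q≢1 q≢-1 e L innermost nv n0 m0 2n0≤B m0≤B))
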